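{- For all nonnegative integers $L,M$, \[ \sum_{i,j\in\mathbb Z} (-1)^i q^{(i+j)^2} \begin{bmatrix}2L\\ L-i\end{bmatrix}_{q^2} \begin{bmatrix}2M\\ M-j\end{bmatrix}_{q^2} = (-1)^M \frac{(q;q^2)_{L-M}}{(-q;q^2)_{L-M}} (q^2;q^4)_L (q^2;q^4)_M . \]
   Context: The Gaussian binomial is $\begin{bmatrix}n+m\\ n\end{bmatrix}_q=\frac{(q)_{n+m}}{(q)_n(q)_m}$ if $n,m$ are nonnegative integers and $0$ otherwise, where $(q)_n=\prod_{j=1}^n(1-q^j)$. The $q$-shifted factorial $(a;q)_n$ is $1$ if $n=0$, $\prod_{j=0}^{n-1}(1-aq^j)$ if $n>0$, and $\prod_{j=1}^{ -n}\frac{1}{1-aq^{ -j}}$ if $n<0$. -}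

module Defs where

open import Data.Nat as ℕ using (ℕ; zero; suc)
open import Data.Integer as ℤ using (ℤ; +_; -[1+_]; ∣_∣)
open import Data.Rational using (ℚ; 0ℚ; 1ℚ; _+_; _*_; _-_; -_; 1/_; ≢-nonZero)
open import Data.Rational.Properties using (_≟_)
open import Relation.Nullary using (yes; no)

_^_ : ℚ → ℕ → ℚ
p ^ zero  = 1ℚ
p ^ suc n = p * (p ^ n)
infixr 8 _^_

-- total inverse on ℚ (convention inv 0 = 0; only used where the
-- argument is nonzero under the theorem's hypotheses)
inv : ℚ → ℚ
inv p with p ≟ 0ℚ
... | yes _  = 0ℚ
... | no p≢0 = 1/_ p {{≢-nonZero p≢0}}

pochPos : ℚ → ℚ → ℕ → ℚ
pochPos a q zero    = 1ℚ
pochPos a q (suc n) = pochPos a q n * (1ℚ - a * q ^ n)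

pochNeg : ℚ → ℚ → ℕ → ℚ
pochNeg a q zero    = 1ℚ
pochNeg a q (suc n) = pochNeg a q n * inv (1ℚ - a * (inv q) ^ suc n)

poch : ℚ → ℚ → ℤ → ℚ
poch a q (+ n)      = pochPos a q n
poch a q -[1+ n ]   = pochNeg a q (suc n)

qfac : ℚ → ℕ → ℚ
qfac q n = pochPos q q n

-- Gaussian binomial [n+m ; n]_q, as a function of (n, m) ∈ ℤ²:
-- (q)_{n+m} / ((q)_n (q)_m) if n, m ≥ 0, and 0 otherwise.
gbin : ℚ → ℤ → ℤ → ℚ
gbin q (+ n) (+ m) = qfac q (n ℕ.+ m) * inv (qfac q n * qfac q m)
gbin q _     _     = 0ℚ

sgn : ℤ → ℚ
sgn i = (- 1ℚ) ^ ∣ i ∣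

symSum : ℕ → (ℤ → ℚ) → ℚ
symSum zero    f = f (+ 0)
symSum (suc N) f = symSum N f + (f (+ suc N) + f -[1+ N ])

-- summand of the left-hand side.  [2L ; L-i]_{q²} = [ (L-i)+(L+i) ; L-i ]_{q²}
lhsTerm : ℚ → ℕ → ℕ → ℤ → ℤ → ℚ
lhsTerm q L M i j =
  sgn i * (q ^ (∣ i ℤ.+ j ∣ ℕ.* ∣ i ℤ.+ j ∣))
    * gbin (q ^ 2) (+ L ℤ.- i) (+ L ℤ.+ i)
    * gbin (q ^ 2) (+ M ℤ.- j) (+ M ℤ.+ j)

-- Σ_{|i| ≤ N, |j| ≤ N} of the summand (the full sum over ℤ² once N ≥ L, M)
lhsSum : ℚ → ℕ → ℕ → ℕ → ℚ
lhsSum q L M N = symSum N (λ i → symSum N (λ j → lhsTerm q L M i j))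

rhs : ℚ → ℕ → ℕ → ℚ
rhs q L M =
  sgn (+ M) * poch q (q ^ 2) (+ L ℤ.- + M) * inv (poch (- q) (q ^ 2) (+ L ℤ.- + M))
    * poch (q ^ 2) (q ^ 4) (+ L) * poch (q ^ 2) (q ^ 4) (+ M)

-- Write F(i,j) for the summand, S(L,M) for the sum and wₖ = q^{2k}. Pascal's rule for Gaussian
-- binomials gives, for cₙ(k) = q^{k²}[2n; n−k]_{q²}, a three-term recurrence in n and a first-order
-- relation between cₙ(k+1) and cₙ(k). Shifting i or j by one in sums of F weighted by 1, w₋ᵢ or w₋ⱼ,
-- and using the symmetry F(−i,−j) = F(i,j), yields four linear relations among the moments ΣF, ΣFwᵢ,
-- ΣFwⱼ, ΣFwᵢwⱼ and ΣFwᵢ/wⱼ; eliminating three of them leaves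
--   (q^{2L} − q^{2M+1}) ΣFwᵢ = (1 − q^{2L+2M+1}) ΣF.
-- With the recurrence in M this gives
--   (q^{2L} − q^{2M+1}) S(L,M+1) = (q^{2L} + q^{2M+1}) (1 − q^{4M+2}) S(L,M),
-- which the right-hand side obeys as well, while S(L,0) = (q;q²)_L² follows from the recurrence in L.
-- For rational q ≠ 0, ±1 the square q² is a positive rational other than 1, so no power of q² is 1;
-- this keeps every denominator, and the factor q^{2L} − q^{2M+1}, nonzero.

module Submission where

open import Defs
open import Level using (0ℓ)
open import Data.Nat as ℕ using (ℕ; zero; suc; z≤n; s≤s; _≤_)
import Data.Nat.Properties as ℕₚ
open import Data.Integer as ℤ using (ℤ; +_; -[1+_]; ∣_∣)
import Data.Integer.Properties as ℤₚ
import Data.Integer.Tactic.RingSolver as ℤ-Solver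
open import Data.Rational as ℚ using (ℚ; 0ℚ; 1ℚ; _+_; _*_; _-_; -_; _<_; ≢-nonZero)
open import Data.Rational.Properties
  using (+-*-commutativeRing; +-0-group; _≟_; +-identityʳ; +-comm; *-identityʳ; *-identityˡ; *-assoc; *-comm;
         *-zeroˡ; *-zeroʳ; *-inverseʳ; <-cmp; <-irrefl; <⇒≤; ≤-refl; ≤-trans; <-≤-trans; ≤-<-trans;
         *-monoˡ-≤-nonNeg; positive⁻¹; neg*neg⇒pos; pos*pos⇒pos)
open import Data.Rational.Base using (positive; negative; nonNegative)
open import Algebra.Properties.Group +-0-group using (x∙y⁻¹≈ε⇒x≈y; x≈y⇒x∙y⁻¹≈ε)
open import Data.Empty using (⊥; ⊥-elim)
open import Data.Sum using (_⊎_; inj₁; inj₂)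
open import Data.Product using (_,_)
open import Relation.Binary.Definitions using (tri<; tri≈; tri>)
open import Relation.Binary.PropositionalEquality
open import Relation.Nullary using (Dec; yes; no)
open import Relation.Nullary.Decidable using (dec⇒maybe)
import Tactic.RingSolver.Core.AlmostCommutativeRing as ACR
open import Tactic.RingSolver using (solve-∀)

ℚ-ring : ACR.AlmostCommutativeRing 0ℓ 0ℓ
ℚ-ring = ACR.fromCommutativeRing +-*-commutativeRing (λ x → dec⇒maybe (0ℚ ≟ x))

-- Arithmetic of ℚ with the total inverse

1≢0 : 1ℚ ≢ 0ℚ
1≢0 ()

inv-inverseʳ : ∀ {a} → a ≢ 0ℚ → a * inv a ≡ 1ℚ
inv-inverseʳ {a} a≢0 with a ≟ 0ℚ
... | yes a≡0 = ⊥-elim (a≢0 a≡0)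
... | no  a≢0′ = *-inverseʳ a {{≢-nonZero a≢0′}}

*-cancelʳ : ∀ {x y c} → c ≢ 0ℚ → x * c ≡ y * c → x ≡ y
*-cancelʳ {x} {y} {c} c≢0 xc≡yc = begin
  x                 ≡⟨ *-identityʳ x ⟨
  x * 1ℚ            ≡⟨ cong (x *_) (inv-inverseʳ c≢0) ⟨
  x * (c * inv c)   ≡⟨ *-assoc x c (inv c) ⟨
  (x * c) * inv c   ≡⟨ cong (_* inv c) xc≡yc ⟩
  (y * c) * inv c   ≡⟨ *-assoc y c (inv c) ⟩
  y * (c * inv c)   ≡⟨ cong (y *_) (inv-inverseʳ c≢0) ⟩
  y * 1ℚ            ≡⟨ *-identityʳ y ⟩
  y                 ∎
  where open ≡-Reasoning

*-cancelˡ : ∀ {x y c} → c ≢ 0ℚ → c * x ≡ c * y → x ≡ y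
*-cancelˡ {x} {y} {c} c≢0 cx≡cy = *-cancelʳ c≢0 (trans (*-comm x c) (trans cx≡cy (*-comm c y)))

*-≢0 : ∀ {a b} → a ≢ 0ℚ → b ≢ 0ℚ → a * b ≢ 0ℚ
*-≢0 {a} {b} a≢0 b≢0 ab≡0 = 1≢0 (begin
  1ℚ                        ≡⟨ cong₂ _*_ (inv-inverseʳ a≢0) (inv-inverseʳ b≢0) ⟨
  (a * inv a) * (b * inv b) ≡⟨ interchange a (inv a) b (inv b) ⟩
  (a * b) * (inv a * inv b) ≡⟨ cong (_* (inv a * inv b)) ab≡0 ⟩
  0ℚ * (inv a * inv b)      ≡⟨ *-zeroˡ (inv a * inv b) ⟩
  0ℚ                        ∎)
  where
  open ≡-Reasoning
  interchange : ∀ a b c d → (a * b) * (c * d) ≡ (a * c) * (b * d)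
  interchange = solve-∀ ℚ-ring

inv-≢0 : ∀ {a} → a ≢ 0ℚ → inv a ≢ 0ℚ
inv-≢0 {a} a≢0 inv-a≡0 =
  1≢0 (trans (sym (inv-inverseʳ a≢0)) (trans (cong (a *_) inv-a≡0) (*-zeroʳ a)))

inv-*-distrib : ∀ a b → inv (a * b) ≡ inv a * inv b
inv-*-distrib a b = by-cases (a ≟ 0ℚ) (b ≟ 0ℚ)
  where
  open ≡-Reasoning
  shuffle : ∀ a b c d → (a * b) * (c * d) ≡ (b * d) * (a * c)
  shuffle = solve-∀ ℚ-ring
  by-cases : Dec (a ≡ 0ℚ) → Dec (b ≡ 0ℚ) → inv (a * b) ≡ inv a * inv b
  by-cases (yes refl) _          = trans (cong inv (*-zeroˡ b)) (sym (*-zeroˡ (inv b)))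
  by-cases (no _)     (yes refl) = trans (cong inv (*-zeroʳ a)) (sym (*-zeroʳ (inv a)))
  by-cases (no a≢0)   (no b≢0)   = *-cancelʳ ab≢0 (begin
    inv (a * b) * (a * b)       ≡⟨ *-comm (inv (a * b)) (a * b) ⟩
    (a * b) * inv (a * b)       ≡⟨ inv-inverseʳ ab≢0 ⟩
    1ℚ                          ≡⟨ cong₂ _*_ (inv-inverseʳ a≢0) (inv-inverseʳ b≢0) ⟨
    (a * inv a) * (b * inv b)   ≡⟨ shuffle a (inv a) b (inv b) ⟩
    (inv a * inv b) * (a * b)   ∎)
    where ab≢0 = *-≢0 a≢0 b≢0

inv-involutive : ∀ a → inv (inv a) ≡ a
inv-involutive a = by-cases (a ≟ 0ℚ)
  where
  open ≡-Reasoning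
  by-cases : Dec (a ≡ 0ℚ) → inv (inv a) ≡ a
  by-cases (yes refl) = refl
  by-cases (no a≢0)   = *-cancelʳ (inv-≢0 a≢0) (begin
    inv (inv a) * inv a   ≡⟨ *-comm (inv (inv a)) (inv a) ⟩
    inv a * inv (inv a)   ≡⟨ inv-inverseʳ (inv-≢0 a≢0) ⟩
    1ℚ                    ≡⟨ inv-inverseʳ a≢0 ⟨
    a * inv a             ∎)

1-x≢0 : ∀ {x} → x ≢ 1ℚ → 1ℚ - x ≢ 0ℚ
1-x≢0 {x} x≢1 1-x≡0 = x≢1 (trans (x≡1-[1-x] x) (cong (λ z → 1ℚ - z) 1-x≡0))
  where
  x≡1-[1-x] : ∀ x → x ≡ 1ℚ - (1ℚ - x)
  x≡1-[1-x] = solve-∀ ℚ-ring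

eliminate-B-C-D : ∀ S A B C D x y q →
  S - y * B ≡ q * C - q * y * A → S - x * A ≡ q * x * B - q * C →
  A - y * D ≡ q * B - q * y * S → B - x * D ≡ q * x * S - q * A →
  (x - q * y) * A ≡ (1ℚ - q * x * y) * S
eliminate-B-C-D S A B C D x y q e₁ e₂ e₃ e₄ = x∙y⁻¹≈ε⇒x≈y _ _ (*-cancelʳ 2≢0 (begin
  T * 2ℚ                                            ≡⟨ combination S A B C D x y q ⟩
  x * d₃ - y * d₄ - d₁ - d₂                         ≡⟨ cong₄ (λ a b c d → x * a - y * b - c - d)
                                                             (x≈y⇒x∙y⁻¹≈ε e₃) (x≈y⇒x∙y⁻¹≈ε e₄)
                                                             (x≈y⇒x∙y⁻¹≈ε e₁) (x≈y⇒x∙y⁻¹≈ε e₂) ⟩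
  x * 0ℚ - y * 0ℚ - 0ℚ - 0ℚ                         ≡⟨ vanish x y ⟩
  0ℚ * 2ℚ                                           ∎))
  where
  open ≡-Reasoning
  2ℚ = 1ℚ + 1ℚ
  2≢0 : 2ℚ ≢ 0ℚ
  2≢0 ()
  T  = (x - q * y) * A - (1ℚ - q * x * y) * S
  d₁ = (S - y * B) - (q * C - q * y * A)
  d₂ = (S - x * A) - (q * x * B - q * C)
  d₃ = (A - y * D) - (q * B - q * y * S)
  d₄ = (B - x * D) - (q * x * S - q * A)
  combination : ∀ S A B C D x y q → ((x - q * y) * A - (1ℚ - q * x * y) * S) * (1ℚ + 1ℚ)
    ≡ x * ((A - y * D) - (q * B - q * y * S)) - y * ((B - x * D) - (q * x * S - q * A))
      - ((S - y * B) - (q * C - q * y * A)) - ((S - x * A) - (q * x * B - q * C))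
  combination = solve-∀ ℚ-ring
  vanish : ∀ x y → x * 0ℚ - y * 0ℚ - 0ℚ - 0ℚ ≡ 0ℚ * (1ℚ + 1ℚ)
  vanish = solve-∀ ℚ-ring
  cong₄ : ∀ {a a′ b b′ c c′ d d′ : ℚ} (f : ℚ → ℚ → ℚ → ℚ → ℚ) →
          a ≡ a′ → b ≡ b′ → c ≡ c′ → d ≡ d′ → f a b c d ≡ f a′ b′ c′ d′
  cong₄ f refl refl refl refl = refl

-- Natural and integer powers

^-distribˡ-+-* : ∀ b m n → b ^ (m ℕ.+ n) ≡ b ^ m * b ^ n
^-distribˡ-+-* b zero    n = sym (*-identityˡ (b ^ n))
^-distribˡ-+-* b (suc m) n =
  trans (cong (b *_) (^-distribˡ-+-* b m n)) (sym (*-assoc b (b ^ m) (b ^ n)))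

^-distribʳ-* : ∀ a b n → (a * b) ^ n ≡ a ^ n * b ^ n
^-distribʳ-* a b zero    = refl
^-distribʳ-* a b (suc n) =
  trans (cong ((a * b) *_) (^-distribʳ-* a b n)) (interchange a b (a ^ n) (b ^ n))
  where
  interchange : ∀ a b c d → (a * b) * (c * d) ≡ (a * c) * (b * d)
  interchange = solve-∀ ℚ-ring

^-zeroˡ : ∀ n → 1ℚ ^ n ≡ 1ℚ
^-zeroˡ zero    = refl
^-zeroˡ (suc n) = trans (*-identityˡ (1ℚ ^ n)) (^-zeroˡ n)

^-≢0 : ∀ {b} → b ≢ 0ℚ → ∀ n → b ^ n ≢ 0ℚ
^-≢0 b≢0 zero    = 1≢0
^-≢0 b≢0 (suc n) = *-≢0 b≢0 (^-≢0 b≢0 n)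

inv-^ : ∀ a n → inv a ^ n ≡ inv (a ^ n)
inv-^ a zero    = refl
inv-^ a (suc n) = trans (cong (inv a *_) (inv-^ a n)) (sym (inv-*-distrib a (a ^ n)))

²-^ : ∀ b n → (b ^ 2) ^ n ≡ b ^ (n ℕ.+ n)
²-^ b n = begin
  (b * (b * 1ℚ)) ^ n ≡⟨ cong (λ z → (b * z) ^ n) (*-identityʳ b) ⟩
  (b * b) ^ n        ≡⟨ ^-distribʳ-* b b n ⟩
  b ^ n * b ^ n      ≡⟨ ^-distribˡ-+-* b n n ⟨
  b ^ (n ℕ.+ n)      ∎
  where open ≡-Reasoning

_^ℤ_ : ℚ → ℤ → ℚ
a ^ℤ (+ n)    = a ^ n
a ^ℤ -[1+ n ] = inv (a ^ suc n)
infixr 8 _^ℤ_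

module _ {a : ℚ} (a≢0 : a ≢ 0ℚ) where

  ^ℤ-suc : ∀ k → a ^ℤ (+ 1 ℤ.+ k) ≡ a * a ^ℤ k
  ^ℤ-suc (+ n)          = refl
  ^ℤ-suc -[1+ zero ]    = sym (trans (cong (λ z → a * inv z) (*-identityʳ a)) (inv-inverseʳ a≢0))
  ^ℤ-suc -[1+ suc n ]   = sym (begin
    a * inv (a * a ^ suc n)           ≡⟨ cong (a *_) (inv-*-distrib a (a ^ suc n)) ⟩
    a * (inv a * inv (a ^ suc n))     ≡⟨ *-assoc a (inv a) _ ⟨
    (a * inv a) * inv (a ^ suc n)     ≡⟨ cong (_* inv (a ^ suc n)) (inv-inverseʳ a≢0) ⟩
    1ℚ * inv (a ^ suc n)              ≡⟨ *-identityˡ _ ⟩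
    inv (a ^ suc n)                   ∎)
    where open ≡-Reasoning

  ^ℤ-+-pos : ∀ m k → a ^ℤ (+ m ℤ.+ k) ≡ a ^ m * a ^ℤ k
  ^ℤ-+-pos zero    k = trans (cong (a ^ℤ_) (ℤₚ.+-identityˡ k)) (sym (*-identityˡ (a ^ℤ k)))
  ^ℤ-+-pos (suc m) k = begin
    a ^ℤ (+ suc m ℤ.+ k)          ≡⟨ cong (a ^ℤ_) (ℤₚ.+-assoc (+ 1) (+ m) k) ⟩
    a ^ℤ (+ 1 ℤ.+ (+ m ℤ.+ k))    ≡⟨ ^ℤ-suc (+ m ℤ.+ k) ⟩
    a * a ^ℤ (+ m ℤ.+ k)          ≡⟨ cong (a *_) (^ℤ-+-pos m k) ⟩
    a * (a ^ m * a ^ℤ k)          ≡⟨ *-assoc a (a ^ m) (a ^ℤ k) ⟨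
    a ^ suc m * a ^ℤ k            ∎
    where open ≡-Reasoning

  ^ℤ-+ : ∀ k l → a ^ℤ (k ℤ.+ l) ≡ a ^ℤ k * a ^ℤ l
  ^ℤ-+ (+ m)    l = ^ℤ-+-pos m l
  ^ℤ-+ -[1+ m ] l = *-cancelʳ (^-≢0 a≢0 (suc m)) (begin
    a ^ℤ (-[1+ m ] ℤ.+ l) * a ^ suc m          ≡⟨ *-comm _ (a ^ suc m) ⟩
    a ^ suc m * a ^ℤ (-[1+ m ] ℤ.+ l)          ≡⟨ ^ℤ-+-pos (suc m) (-[1+ m ] ℤ.+ l) ⟨
    a ^ℤ (+ suc m ℤ.+ (-[1+ m ] ℤ.+ l))        ≡⟨ cong (a ^ℤ_) (cancel (+ suc m) l) ⟩
    a ^ℤ l                                     ≡⟨ *-identityˡ (a ^ℤ l) ⟨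
    1ℚ * a ^ℤ l                                ≡⟨ cong (_* a ^ℤ l) (inv-inverseʳ (^-≢0 a≢0 (suc m))) ⟨
    (a ^ suc m * inv (a ^ suc m)) * a ^ℤ l     ≡⟨ rotate (a ^ suc m) (inv (a ^ suc m)) (a ^ℤ l) ⟩
    (inv (a ^ suc m) * a ^ℤ l) * a ^ suc m     ∎)
    where
    open ≡-Reasoning
    cancel : ∀ k l → k ℤ.+ (ℤ.- k ℤ.+ l) ≡ l
    cancel = ℤ-Solver.solve-∀
    rotate : ∀ a b c → (a * b) * c ≡ (b * c) * a
    rotate = solve-∀ ℚ-ring

  ^ℤ-inverse : ∀ k → a ^ℤ k * a ^ℤ (ℤ.- k) ≡ 1ℚ
  ^ℤ-inverse k = trans (sym (^ℤ-+ k (ℤ.- k))) (cong (a ^ℤ_) (ℤₚ.+-inverseʳ k))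

²-^ℤ : ∀ a k → (a ^ 2) ^ℤ k ≡ a ^ℤ (k ℤ.+ k)
²-^ℤ a (+ n)    = ²-^ a n
²-^ℤ a -[1+ n ] =
  cong inv (trans (²-^ a (suc n)) (cong (λ m → a ^ suc m) (ℕₚ.+-suc n n)))

pos-^-suc≢1 : ∀ {r} → 0ℚ < r → r ≢ 1ℚ → ∀ m → r ^ suc m ≢ 1ℚ
pos-^-suc≢1 {r} 0<r r≢1 m rᵐ⁺¹≡1 with <-cmp r 1ℚ
... | tri< r<1 _ _ = <-irrefl refl
  (subst (_< 1ℚ) rᵐ⁺¹≡1 (≤-<-trans (*-monoˡ-≤-nonNeg r (^≤1 r<1 m)) (subst (_< 1ℚ) (sym (*-identityʳ r)) r<1)))
  where
  instance _ = nonNegative (<⇒≤ 0<r)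
  ^≤1 : r < 1ℚ → ∀ m → r ^ m ℚ.≤ 1ℚ
  ^≤1 r<1 zero    = ≤-refl
  ^≤1 r<1 (suc m) = ≤-trans (*-monoˡ-≤-nonNeg r (^≤1 r<1 m)) (subst (ℚ._≤ 1ℚ) (sym (*-identityʳ r)) (<⇒≤ r<1))
... | tri≈ _ r≡1 _ = r≢1 r≡1
... | tri> _ _ 1<r = <-irrefl refl
  (subst (1ℚ <_) rᵐ⁺¹≡1 (<-≤-trans (subst (1ℚ <_) (sym (*-identityʳ r)) 1<r) (*-monoˡ-≤-nonNeg r (1≤^ 1<r m))))
  where
  instance _ = nonNegative (<⇒≤ 0<r)
  1≤^ : 1ℚ < r → ∀ m → 1ℚ ℚ.≤ r ^ m
  1≤^ 1<r zero    = ≤-refl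
  1≤^ 1<r (suc m) = ≤-trans (subst (1ℚ ℚ.≤_) (sym (*-identityʳ r)) (<⇒≤ 1<r)) (*-monoˡ-≤-nonNeg r (1≤^ 1<r m))

²-pos : ∀ {q} → q ≢ 0ℚ → 0ℚ < q ^ 2
²-pos {q} q≢0 with <-cmp q 0ℚ
... | tri< q<0 _ _ = positive⁻¹ (q ^ 2)
  {{neg*neg⇒pos q {{negative q<0}} (q * 1ℚ) {{subst ℚ.Negative (sym (*-identityʳ q)) (negative q<0)}}}}
... | tri≈ _ q≡0 _ = ⊥-elim (q≢0 q≡0)
... | tri> _ _ 0<q = positive⁻¹ (q ^ 2)
  {{pos*pos⇒pos q {{positive 0<q}} (q * 1ℚ) {{subst ℚ.Positive (sym (*-identityʳ q)) (positive 0<q)}}}}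

²≢1 : ∀ {q} → q ≢ 1ℚ → q ≢ - 1ℚ → q ^ 2 ≢ 1ℚ
²≢1 {q} q≢1 q≢-1 q²≡1 = *-≢0 (λ e → q≢1 (x-1≡0 e)) (λ e → q≢-1 (x+1≡0 e)) (begin
  (q - 1ℚ) * (q + 1ℚ) ≡⟨ difference-of-squares q ⟩
  q ^ 2 - 1ℚ          ≡⟨ cong (_- 1ℚ) q²≡1 ⟩
  1ℚ - 1ℚ             ≡⟨⟩
  0ℚ                  ∎)
  where
  open ≡-Reasoning
  difference-of-squares : ∀ x → (x - 1ℚ) * (x + 1ℚ) ≡ x * (x * 1ℚ) - 1ℚ
  difference-of-squares = solve-∀ ℚ-ring
  x-1≡0 : ∀ {x} → x - 1ℚ ≡ 0ℚ → x ≡ 1ℚ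
  x-1≡0 {x} e = trans (x≡[x-1]+1 x) (cong (_+ 1ℚ) e)
    where x≡[x-1]+1 : ∀ x → x ≡ (x - 1ℚ) + 1ℚ
          x≡[x-1]+1 = solve-∀ ℚ-ring
  x+1≡0 : ∀ {x} → x + 1ℚ ≡ 0ℚ → x ≡ - 1ℚ
  x+1≡0 {x} e = trans (x≡[x+1]-1 x) (cong (_- 1ℚ) e)
    where x≡[x+1]-1 : ∀ x → x ≡ (x + 1ℚ) - 1ℚ
          x≡[x+1]-1 = solve-∀ ℚ-ring

-- Gaussian binomials

0≡0+x*0 : ∀ x → 0ℚ ≡ 0ℚ + x * 0ℚ
0≡0+x*0 = solve-∀ ℚ-ring

expansions-difference : ∀ A C a c {L} → L ≡ A + a * C → L ≡ C + c * A → C * (1ℚ - a) ≡ A * (1ℚ - c)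
expansions-difference A C a c L≡A+aC L≡C+cA = begin
  C * (1ℚ - a)                        ≡⟨ expand₁ A C a c ⟩
  (C + c * A) - (a * C + c * A)       ≡⟨ cong (_- (a * C + c * A)) (trans (sym L≡C+cA) L≡A+aC) ⟩
  (A + a * C) - (a * C + c * A)       ≡⟨ expand₂ A C a c ⟩
  A * (1ℚ - c)                        ∎
  where
  open ≡-Reasoning
  expand₁ : ∀ A C a c → C * (1ℚ - a) ≡ (C + c * A) - (a * C + c * A)
  expand₁ = solve-∀ ℚ-ring
  expand₂ : ∀ A C a c → (A + a * C) - (a * C + c * A) ≡ A * (1ℚ - c)
  expand₂ = solve-∀ ℚ-ring

module _ {p : ℚ} (p^suc≢1 : ∀ k → p ^ suc k ≢ 1ℚ) where

  qfac-≢0 : ∀ k → qfac p k ≢ 0ℚ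
  qfac-≢0 zero    = 1≢0
  qfac-≢0 (suc k) = *-≢0 (qfac-≢0 k) (1-x≢0 (p^suc≢1 k))

  gbin-zeroˡ : ∀ n → gbin p (+ 0) (+ n) ≡ 1ℚ
  gbin-zeroˡ n = trans (cong (λ z → qfac p n * inv z) (*-identityˡ (qfac p n))) (inv-inverseʳ (qfac-≢0 n))

  gbin-zeroʳ : ∀ m → gbin p (+ m) (+ 0) ≡ 1ℚ
  gbin-zeroʳ m = trans (cong₂ (λ a b → qfac p a * inv b) (ℕₚ.+-identityʳ m) (*-identityʳ (qfac p m)))
                       (inv-inverseʳ (qfac-≢0 m))

  gbin-sym : ∀ a b → gbin p a b ≡ gbin p b a
  gbin-sym (+ m)    (+ n)    = cong₂ (λ a b → qfac p a * inv b) (ℕₚ.+-comm m n) (*-comm (qfac p m) (qfac p n))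
  gbin-sym (+ m)    -[1+ n ] = refl
  gbin-sym -[1+ m ] (+ n)    = refl
  gbin-sym -[1+ m ] -[1+ n ] = refl

  gbin-pascal : ∀ m n → gbin p (+ suc m) (+ suc n) ≡ gbin p (+ m) (+ suc n) + p ^ suc m * gbin p (+ suc m) (+ n)
  gbin-pascal m n = begin
    K * (1ℚ - p ^ (suc m ℕ.+ suc n)) * inv ((Fm * (1ℚ - x)) * (Fn * (1ℚ - y)))
      ≡⟨ cong₂ (λ u v → K * (1ℚ - u) * v) (^-distribˡ-+-* p (suc m) (suc n)) inv-denominator ⟩
    K * (1ℚ - x * y) * ((inv Fm * ix) * (inv Fn * iy))
      ≡⟨ split K (inv Fm) (inv Fn) x y ix iy ⟩
    K * (inv Fm * (inv Fn * iy)) * ((1ℚ - x) * ix) + x * (K * ((inv Fm * ix) * inv Fn)) * ((1ℚ - y) * iy)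
      ≡⟨ cong₂ (λ u v → K * (inv Fm * (inv Fn * iy)) * u + x * (K * ((inv Fm * ix) * inv Fn)) * v)
               (inv-inverseʳ (1-x≢0 (p^suc≢1 m))) (inv-inverseʳ (1-x≢0 (p^suc≢1 n))) ⟩
    K * (inv Fm * (inv Fn * iy)) * 1ℚ + x * (K * ((inv Fm * ix) * inv Fn)) * 1ℚ
      ≡⟨ cong₂ (λ u v → K * u * 1ℚ + x * (qfac p v * ((inv Fm * ix) * inv Fn)) * 1ℚ)
               (sym (trans (inv-*-distrib Fm (Fn * (1ℚ - y))) (cong (inv Fm *_) (inv-*-distrib Fn (1ℚ - y)))))
               (ℕₚ.+-suc m n) ⟩
    K * inv (Fm * (Fn * (1ℚ - y))) * 1ℚ + x * (qfac p (suc m ℕ.+ n) * ((inv Fm * ix) * inv Fn)) * 1ℚ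
      ≡⟨ cong (λ v → K * inv (Fm * (Fn * (1ℚ - y))) * 1ℚ + x * (qfac p (suc m ℕ.+ n) * v) * 1ℚ)
               (sym (trans (inv-*-distrib (Fm * (1ℚ - x)) Fn) (cong (_* inv Fn) (inv-*-distrib Fm (1ℚ - x))))) ⟩
    gbin p (+ m) (+ suc n) * 1ℚ + p ^ suc m * gbin p (+ suc m) (+ n) * 1ℚ
      ≡⟨ cong₂ _+_ (*-identityʳ (gbin p (+ m) (+ suc n))) (*-identityʳ (p ^ suc m * gbin p (+ suc m) (+ n))) ⟩
    gbin p (+ m) (+ suc n) + p ^ suc m * gbin p (+ suc m) (+ n) ∎
    where
    open ≡-Reasoning
    K  = qfac p (m ℕ.+ suc n)
    Fm = qfac p m
    Fn = qfac p n
    x  = p ^ suc m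
    y  = p ^ suc n
    ix = inv (1ℚ - x)
    iy = inv (1ℚ - y)
    inv-denominator : inv ((Fm * (1ℚ - x)) * (Fn * (1ℚ - y))) ≡ (inv Fm * ix) * (inv Fn * iy)
    inv-denominator = trans (inv-*-distrib (Fm * (1ℚ - x)) (Fn * (1ℚ - y)))
                            (cong₂ _*_ (inv-*-distrib Fm (1ℚ - x)) (inv-*-distrib Fn (1ℚ - y)))
    split : ∀ K a b x y ix iy → K * (1ℚ - x * y) * ((a * ix) * (b * iy))
          ≡ K * (a * (b * iy)) * ((1ℚ - x) * ix) + x * (K * ((a * ix) * b)) * ((1ℚ - y) * iy)
    split = solve-∀ ℚ-ring

  -- The integer-indexed form holds at every (a, b) except (-1, -1), where
  -- the left side is gbin p 0 0 = 1 but every term on the right vanishes.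
  gbin-pascalℤ : ∀ a b → (a ≡ -[1+ 0 ] → b ≡ -[1+ 0 ] → ⊥) →
    gbin p (+ 1 ℤ.+ a) (+ 1 ℤ.+ b) ≡ gbin p a (+ 1 ℤ.+ b) + p ^ℤ (+ 1 ℤ.+ a) * gbin p (+ 1 ℤ.+ a) b
  gbin-pascalℤ (+ m)          (+ n)          _ = gbin-pascal m n
  gbin-pascalℤ (+ m)          -[1+ zero ]    _ =
    trans (gbin-zeroʳ (suc m)) (trans (sym (gbin-zeroʳ m)) (sym (x+y*0≡x (gbin p (+ m) (+ 0)) (p ^ suc m))))
    where x+y*0≡x : ∀ x y → x + y * 0ℚ ≡ x
          x+y*0≡x = solve-∀ ℚ-ring
  gbin-pascalℤ (+ m)          -[1+ suc n ]   _ = 0≡0+x*0 (p ^ suc m)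
  gbin-pascalℤ -[1+ zero ]    (+ n)          _ =
    trans (gbin-zeroˡ (suc n)) (trans (sym (gbin-zeroˡ n)) (sym (0+1*x≡x (gbin p (+ 0) (+ n)))))
    where 0+1*x≡x : ∀ x → 0ℚ + 1ℚ * x ≡ x
          0+1*x≡x = solve-∀ ℚ-ring
  gbin-pascalℤ -[1+ zero ]    -[1+ zero ]    h = ⊥-elim (h refl refl)
  gbin-pascalℤ -[1+ zero ]    -[1+ suc n ]   _ = 0≡0+x*0 1ℚ
  gbin-pascalℤ -[1+ suc m ]   b              _ = 0≡0+x*0 (p ^ℤ -[1+ m ])

  gbin-pascalℤ′ : ∀ a b → (a ≡ -[1+ 0 ] → b ≡ -[1+ 0 ] → ⊥) →
    gbin p (+ 1 ℤ.+ a) (+ 1 ℤ.+ b) ≡ gbin p (+ 1 ℤ.+ a) b + p ^ℤ (+ 1 ℤ.+ b) * gbin p a (+ 1 ℤ.+ b)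
  gbin-pascalℤ′ a b h = begin
    gbin p (+ 1 ℤ.+ a) (+ 1 ℤ.+ b)                                    ≡⟨ gbin-sym (+ 1 ℤ.+ a) (+ 1 ℤ.+ b) ⟩
    gbin p (+ 1 ℤ.+ b) (+ 1 ℤ.+ a)                                    ≡⟨ gbin-pascalℤ b a (λ b≡-1 a≡-1 → h a≡-1 b≡-1) ⟩
    gbin p b (+ 1 ℤ.+ a) + p ^ℤ (+ 1 ℤ.+ b) * gbin p (+ 1 ℤ.+ b) a   ≡⟨ cong₂ (λ u v → u + p ^ℤ (+ 1 ℤ.+ b) * v)
                                                                               (gbin-sym b (+ 1 ℤ.+ a)) (gbin-sym (+ 1 ℤ.+ b) a) ⟩
    gbin p (+ 1 ℤ.+ a) b + p ^ℤ (+ 1 ℤ.+ b) * gbin p a (+ 1 ℤ.+ b)   ∎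
    where open ≡-Reasoning

  private
    gbin-ratio-away : ∀ a b → (a ≡ -[1+ 0 ] → b ≡ -[1+ 0 ] → ⊥) →
      gbin p (+ 1 ℤ.+ a) b * (1ℚ - p ^ℤ (+ 1 ℤ.+ a)) ≡ gbin p a (+ 1 ℤ.+ b) * (1ℚ - p ^ℤ (+ 1 ℤ.+ b))
    gbin-ratio-away a b h = expansions-difference (gbin p a (+ 1 ℤ.+ b)) (gbin p (+ 1 ℤ.+ a) b)
      (p ^ℤ (+ 1 ℤ.+ a)) (p ^ℤ (+ 1 ℤ.+ b)) (gbin-pascalℤ a b h) (gbin-pascalℤ′ a b h)

  gbin-ratio : ∀ a b →
    gbin p (+ 1 ℤ.+ a) b * (1ℚ - p ^ℤ (+ 1 ℤ.+ a)) ≡ gbin p a (+ 1 ℤ.+ b) * (1ℚ - p ^ℤ (+ 1 ℤ.+ b))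
  gbin-ratio a b with a ℤ.≟ -[1+ 0 ] | b ℤ.≟ -[1+ 0 ]
  ... | yes refl | yes refl = refl
  ... | no a≢-1  | _        = gbin-ratio-away a b (λ a≡-1 _ → a≢-1 a≡-1)
  ... | yes _    | no b≢-1  = gbin-ratio-away a b (λ _ b≡-1 → b≢-1 b≡-1)

  gbin-three-term : ∀ a b → + 0 ℤ.≤ (a ℤ.+ b) ℤ.+ + 2 →
    gbin p (+ 1 ℤ.+ (+ 1 ℤ.+ a)) (+ 1 ℤ.+ (+ 1 ℤ.+ b)) ≡
      (1ℚ + p ^ℤ (+ 1 ℤ.+ (+ 1 ℤ.+ a)) * p ^ℤ (+ 1 ℤ.+ b)) * gbin p (+ 1 ℤ.+ a) (+ 1 ℤ.+ b)
      + p ^ℤ (+ 1 ℤ.+ (+ 1 ℤ.+ a)) * gbin p (+ 1 ℤ.+ (+ 1 ℤ.+ a)) b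
      + p ^ℤ (+ 1 ℤ.+ (+ 1 ℤ.+ b)) * gbin p a (+ 1 ℤ.+ (+ 1 ℤ.+ b))
  gbin-three-term a b 0≤a+b+2 = begin
    G A2 B2                                  ≡⟨ gbin-pascalℤ A1 B1 excluded₁₁ ⟩
    G A1 B2 + pa * G A2 B1                   ≡⟨ cong₂ (λ u v → u + pa * v) (gbin-pascalℤ′ a B1 excluded₀₁) (gbin-pascalℤ A1 b excluded₁₀) ⟩
    (G₀ + pb2 * g2) + pa * (G₀ + pa * g1)    ≡⟨ regroup G₀ g1 g2 pa pb1 pb2 ⟩
    rhs′ + pa * (G₀ * (1ℚ - pb1) - g1 * (1ℚ - pa))
                                             ≡⟨ cong (λ z → rhs′ + pa * (G₀ * (1ℚ - pb1) - z)) (gbin-ratio A1 b) ⟩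
    rhs′ + pa * (G₀ * (1ℚ - pb1) - G₀ * (1ℚ - pb1))
                                             ≡⟨ x+y*[z-z]≡x rhs′ pa (G₀ * (1ℚ - pb1)) ⟩
    rhs′                                     ∎
    where
    open ≡-Reasoning
    G = gbin p
    A1 = + 1 ℤ.+ a
    A2 = + 1 ℤ.+ A1
    B1 = + 1 ℤ.+ b
    B2 = + 1 ℤ.+ B1
    G₀ = G A1 B1
    g1 = G A2 b
    g2 = G a B2
    pa = p ^ℤ A2
    pb1 = p ^ℤ B1
    pb2 = p ^ℤ B2
    rhs′ = (1ℚ + pa * pb1) * G₀ + pa * g1 + pb2 * g2
    regroup : ∀ G₀ g1 g2 pa pb1 pb2 → (G₀ + pb2 * g2) + pa * (G₀ + pa * g1)
            ≡ ((1ℚ + pa * pb1) * G₀ + pa * g1 + pb2 * g2) + pa * (G₀ * (1ℚ - pb1) - g1 * (1ℚ - pa))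
    regroup = solve-∀ ℚ-ring
    x+y*[z-z]≡x : ∀ x y z → x + y * (z - z) ≡ x
    x+y*[z-z]≡x = solve-∀ ℚ-ring
    1+x≡-1⇒x≡-2 : ∀ {x} → + 1 ℤ.+ x ≡ -[1+ 0 ] → x ≡ -[1+ 1 ]
    1+x≡-1⇒x≡-2 {x} e = trans (shift x) (cong (λ z → (ℤ.- + 1) ℤ.+ z) e)
      where shift : ∀ x → x ≡ (ℤ.- + 1) ℤ.+ (+ 1 ℤ.+ x)
            shift = ℤ-Solver.solve-∀
    bound : ∀ {a′ b′} → a ≡ a′ → b ≡ b′ → + 0 ℤ.≤ (a′ ℤ.+ b′) ℤ.+ + 2
    bound refl refl = 0≤a+b+2
    excluded₁₁ : A1 ≡ -[1+ 0 ] → B1 ≡ -[1+ 0 ] → ⊥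
    excluded₁₁ eA eB with bound (1+x≡-1⇒x≡-2 eA) (1+x≡-1⇒x≡-2 eB)
    ... | ()
    excluded₀₁ : a ≡ -[1+ 0 ] → B1 ≡ -[1+ 0 ] → ⊥
    excluded₀₁ eA eB with bound eA (1+x≡-1⇒x≡-2 eB)
    ... | ()
    excluded₁₀ : A1 ≡ -[1+ 0 ] → b ≡ -[1+ 0 ] → ⊥
    excluded₁₀ eA eB with bound (1+x≡-1⇒x≡-2 eA) eB
    ... | ()

-- Symmetric sums

VanishesBeyond : ℕ → (ℤ → ℚ) → Set
VanishesBeyond n f = ∀ k → n ℕ.< ∣ k ∣ → f k ≡ 0ℚ

symSum-cong : ∀ N {f g : ℤ → ℚ} → (∀ k → f k ≡ g k) → symSum N f ≡ symSum N g
symSum-cong zero    f≗g = f≗g (+ 0)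
symSum-cong (suc N) f≗g = cong₂ _+_ (symSum-cong N f≗g) (cong₂ _+_ (f≗g _) (f≗g _))

symSum-+ : ∀ N (f g : ℤ → ℚ) → symSum N (λ k → f k + g k) ≡ symSum N f + symSum N g
symSum-+ zero    f g = refl
symSum-+ (suc N) f g = trans (cong (_+ ((f (+ suc N) + g (+ suc N)) + (f -[1+ N ] + g -[1+ N ]))) (symSum-+ N f g))
                             (regroup (symSum N f) (symSum N g) (f (+ suc N)) (g (+ suc N)) (f -[1+ N ]) (g -[1+ N ]))
  where
  regroup : ∀ a b c d e h → (a + b) + ((c + d) + (e + h)) ≡ (a + (c + e)) + (b + (d + h))
  regroup = solve-∀ ℚ-ring

symSum-*ˡ : ∀ N c (f : ℤ → ℚ) → symSum N (λ k → c * f k) ≡ c * symSum N f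
symSum-*ˡ zero    c f = refl
symSum-*ˡ (suc N) c f = trans (cong (_+ (c * f (+ suc N) + c * f -[1+ N ])) (symSum-*ˡ N c f))
                              (factor c (symSum N f) (f (+ suc N)) (f -[1+ N ]))
  where
  factor : ∀ c a b d → c * a + (c * b + c * d) ≡ c * (a + (b + d))
  factor = solve-∀ ℚ-ring

symSum-reflect : ∀ N (f : ℤ → ℚ) → symSum N (λ k → f (ℤ.- k)) ≡ symSum N f
symSum-reflect zero    f = refl
symSum-reflect (suc N) f = cong₂ _+_ (symSum-reflect N f) (+-comm (f -[1+ N ]) (f (+ suc N)))

symSum-zero : ∀ N (f : ℤ → ℚ) → (∀ k → f k ≡ 0ℚ) → symSum N f ≡ 0ℚ
symSum-zero zero    f f≗0 = f≗0 (+ 0)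
symSum-zero (suc N) f f≗0 = trans (cong₂ _+_ (symSum-zero N f f≗0) (cong₂ _+_ (f≗0 _) (f≗0 _))) refl

symSum-concentrated : ∀ N (f : ℤ → ℚ) → VanishesBeyond 0 f → symSum N f ≡ f (+ 0)
symSum-concentrated zero    f f≈0 = refl
symSum-concentrated (suc N) f f≈0 =
  trans (cong₂ (λ x y → symSum N f + (x + y)) (f≈0 (+ suc N) (s≤s z≤n)) (f≈0 -[1+ N ] (s≤s z≤n)))
        (trans (+-identityʳ (symSum N f)) (symSum-concentrated N f f≈0))

symSum-extend : ∀ N (f : ℤ → ℚ) → VanishesBeyond N f → symSum (suc N) f ≡ symSum N f
symSum-extend N f f≈0 =
  trans (cong₂ (λ x y → symSum N f + (x + y)) (f≈0 (+ suc N) (ℕₚ.n<1+n N)) (f≈0 -[1+ N ] (ℕₚ.n<1+n N)))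
        (+-identityʳ (symSum N f))

symSum-shift : ∀ N (f : ℤ → ℚ) →
  symSum N (λ k → f (k ℤ.+ + 1)) + f (ℤ.- (+ N)) ≡ symSum N f + f (+ suc N)
symSum-shift zero    f = +-comm (f (+ 1)) (f (+ 0))
symSum-shift (suc N) f = begin
  (symSum N g + (f (+ suc N ℤ.+ + 1) + f (-[1+ N ] ℤ.+ + 1))) + f -[1+ N ]
    ≡⟨ cong₂ (λ x y → (symSum N g + (x + y)) + f -[1+ N ]) (cong (λ n → f (+ n)) (ℕₚ.+-comm (suc N) 1)) (cong f (-[1+N]+1 N)) ⟩
  (symSum N g + (f (+ suc (suc N)) + f (ℤ.- (+ N)))) + f -[1+ N ]
    ≡⟨ regroup₁ (symSum N g) (f (+ suc (suc N))) (f (ℤ.- (+ N))) (f -[1+ N ]) ⟩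
  (symSum N g + f (ℤ.- (+ N))) + (f (+ suc (suc N)) + f -[1+ N ])
    ≡⟨ cong (_+ (f (+ suc (suc N)) + f -[1+ N ])) (symSum-shift N f) ⟩
  (symSum N f + f (+ suc N)) + (f (+ suc (suc N)) + f -[1+ N ])
    ≡⟨ regroup₂ (symSum N f) (f (+ suc N)) (f (+ suc (suc N))) (f -[1+ N ]) ⟩
  (symSum N f + (f (+ suc N) + f -[1+ N ])) + f (+ suc (suc N)) ∎
  where
  open ≡-Reasoning
  g = λ k → f (k ℤ.+ + 1)
  -[1+N]+1 : ∀ N → -[1+ N ] ℤ.+ + 1 ≡ ℤ.- (+ N)
  -[1+N]+1 zero    = refl
  -[1+N]+1 (suc N) = refl
  regroup₁ : ∀ a b c d → (a + (b + c)) + d ≡ (a + c) + (b + d)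
  regroup₁ = solve-∀ ℚ-ring
  regroup₂ : ∀ a b c d → (a + b) + (c + d) ≡ (a + (b + d)) + c
  regroup₂ = solve-∀ ℚ-ring

symSum-shift-vanishing : ∀ N (f : ℤ → ℚ) → f (ℤ.- (+ N)) ≡ 0ℚ → f (+ suc N) ≡ 0ℚ →
  symSum N (λ k → f (k ℤ.+ + 1)) ≡ symSum N f
symSum-shift-vanishing N f f[-N]≡0 f[N+1]≡0 = begin
  symSum N g                     ≡⟨ +-identityʳ (symSum N g) ⟨
  symSum N g + 0ℚ                ≡⟨ cong (λ z → symSum N g + z) f[-N]≡0 ⟨
  symSum N g + f (ℤ.- (+ N))     ≡⟨ symSum-shift N f ⟩
  symSum N f + f (+ suc N)       ≡⟨ cong (λ z → symSum N f + z) f[N+1]≡0 ⟩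
  symSum N f + 0ℚ                ≡⟨ +-identityʳ (symSum N f) ⟩
  symSum N f                     ∎
  where
  open ≡-Reasoning
  g = λ k → f (k ℤ.+ + 1)

symSum-shift⁺ : ∀ {n} N (f : ℤ → ℚ) → VanishesBeyond n f → n ℕ.< N →
  symSum N (λ k → f (k ℤ.+ + 1)) ≡ symSum N f
symSum-shift⁺ N f f≈0 n<N = symSum-shift-vanishing N f
  (f≈0 (ℤ.- (+ N)) (subst (_ ℕ.<_) (sym (ℤₚ.∣-i∣≡∣i∣ (+ N))) n<N))
  (f≈0 (+ suc N) (ℕₚ.m<n⇒m<1+n n<N))

symSum-shift⁻ : ∀ {n} N (f : ℤ → ℚ) → VanishesBeyond n f → n ℕ.< N →
  symSum N (λ k → f (k ℤ.- + 1)) ≡ symSum N f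
symSum-shift⁻ N f f≈0 n<N = begin
  symSum N (λ k → f (k ℤ.- + 1))              ≡⟨ symSum-shift-vanishing N (λ k → f (k ℤ.- + 1))
                                                   (trans (cong f (-K-1 (+ N))) (f≈0 -[1+ N ] (ℕₚ.m<n⇒m<1+n n<N)))
                                                   (f≈0 (+ N) n<N) ⟨
  symSum N (λ k → f (k ℤ.+ + 1 ℤ.- + 1))      ≡⟨ symSum-cong N (λ k → cong f (k+1-1 k)) ⟩
  symSum N f                                  ∎
  where
  open ≡-Reasoning
  k+1-1 : ∀ k → k ℤ.+ + 1 ℤ.- + 1 ≡ k
  k+1-1 = ℤ-Solver.solve-∀
  -K-1 : ∀ K → ℤ.- K ℤ.- + 1 ≡ ℤ.- (+ 1 ℤ.+ K)
  -K-1 = ℤ-Solver.solve-∀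

doubleSum : ℕ → (ℤ → ℤ → ℚ) → ℚ
doubleSum N f = symSum N (λ i → symSum N (f i))

VanishesOutside : ℕ → ℕ → (ℤ → ℤ → ℚ) → Set
VanishesOutside L M f = ∀ i j → L ℕ.< ∣ i ∣ ⊎ M ℕ.< ∣ j ∣ → f i j ≡ 0ℚ

module _ {L M : ℕ} {f : ℤ → ℤ → ℚ} (f≈0 : VanishesOutside L M f) where

  vanishesOutside-*ˡ : ∀ (g : ℤ → ℤ → ℚ) → VanishesOutside L M (λ i j → g i j * f i j)
  vanishesOutside-*ˡ g i j out = trans (cong (g i j *_) (f≈0 i j out)) (*-zeroʳ (g i j))

  vanishesOutside-*ʳ : ∀ (g : ℤ → ℤ → ℚ) → VanishesOutside L M (λ i j → f i j * g i j)
  vanishesOutside-*ʳ g i j out = trans (cong (_* g i j) (f≈0 i j out)) (*-zeroˡ (g i j))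

  doubleSum-shiftʲ⁺ : ∀ {N} → M ℕ.< N → doubleSum N (λ i j → f i (j ℤ.+ + 1)) ≡ doubleSum N f
  doubleSum-shiftʲ⁺ {N} M<N = symSum-cong N (λ i → symSum-shift⁺ N (f i) (λ j M<∣j∣ → f≈0 i j (inj₂ M<∣j∣)) M<N)

  doubleSum-shiftʲ⁻ : ∀ {N} → M ℕ.< N → doubleSum N (λ i j → f i (j ℤ.- + 1)) ≡ doubleSum N f
  doubleSum-shiftʲ⁻ {N} M<N = symSum-cong N (λ i → symSum-shift⁻ N (f i) (λ j M<∣j∣ → f≈0 i j (inj₂ M<∣j∣)) M<N)

  rowSums-vanish : ∀ N → VanishesBeyond L (λ i → symSum N (f i))
  rowSums-vanish N i L<∣i∣ = symSum-zero N (f i) (λ j → f≈0 i j (inj₁ L<∣i∣))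

  doubleSum-shiftⁱ⁺ : ∀ {N} → L ℕ.< N → doubleSum N (λ i j → f (i ℤ.+ + 1) j) ≡ doubleSum N f
  doubleSum-shiftⁱ⁺ {N} L<N = symSum-shift⁺ N (λ i → symSum N (f i)) (rowSums-vanish N) L<N

  doubleSum-shiftⁱ⁻ : ∀ {N} → L ℕ.< N → doubleSum N (λ i j → f (i ℤ.- + 1) j) ≡ doubleSum N f
  doubleSum-shiftⁱ⁻ {N} L<N = symSum-shift⁻ N (λ i → symSum N (f i)) (rowSums-vanish N) L<N

  doubleSum-extend : ∀ {N} → L ℕ.≤ N → M ℕ.≤ N → doubleSum (suc N) f ≡ doubleSum N f
  doubleSum-extend {N} L≤N M≤N = begin
    symSum (suc N) (λ i → symSum (suc N) (f i))   ≡⟨ symSum-cong (suc N) (λ i → symSum-extend N (f i)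
                                                        (λ j N<∣j∣ → f≈0 i j (inj₂ (ℕₚ.≤-<-trans M≤N N<∣j∣)))) ⟩
    symSum (suc N) (λ i → symSum N (f i))         ≡⟨ symSum-extend N (λ i → symSum N (f i))
                                                        (λ i N<∣i∣ → rowSums-vanish N i (ℕₚ.≤-<-trans L≤N N<∣i∣)) ⟩
    doubleSum N f                                 ∎
    where open ≡-Reasoning

doubleSum-cong : ∀ N {f g : ℤ → ℤ → ℚ} → (∀ i j → f i j ≡ g i j) → doubleSum N f ≡ doubleSum N g
doubleSum-cong N f≗g = symSum-cong N (λ i → symSum-cong N (f≗g i))

doubleSum-+ : ∀ N (f g : ℤ → ℤ → ℚ) → doubleSum N (λ i j → f i j + g i j) ≡ doubleSum N f + doubleSum N g
doubleSum-+ N f g = trans (symSum-cong N (λ i → symSum-+ N (f i) (g i)))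
                          (symSum-+ N (λ i → symSum N (f i)) (λ i → symSum N (g i)))

doubleSum-*ˡ : ∀ N a (f : ℤ → ℤ → ℚ) → doubleSum N (λ i j → a * f i j) ≡ a * doubleSum N f
doubleSum-*ˡ N a f = trans (symSum-cong N (λ i → symSum-*ˡ N a (f i))) (symSum-*ˡ N a (λ i → symSum N (f i)))

doubleSum-linear : ∀ N a b (f g : ℤ → ℤ → ℚ) →
  doubleSum N (λ i j → a * f i j + b * g i j) ≡ a * doubleSum N f + b * doubleSum N g
doubleSum-linear N a b f g = trans (doubleSum-+ N (λ i j → a * f i j) (λ i j → b * g i j))
                                   (cong₂ _+_ (doubleSum-*ˡ N a f) (doubleSum-*ˡ N b g))

doubleSum-reflect : ∀ N (f : ℤ → ℤ → ℚ) → doubleSum N (λ i j → f (ℤ.- i) (ℤ.- j)) ≡ doubleSum N f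
doubleSum-reflect N f = trans (symSum-cong N (λ i → symSum-reflect N (f (ℤ.- i))))
                              (symSum-reflect N (λ i → symSum N (f i)))

x≡-1*[-1*x] : ∀ x → x ≡ - 1ℚ * (- 1ℚ * x)
x≡-1*[-1*x] = solve-∀ ℚ-ring

sgn-neg : ∀ i → sgn (ℤ.- i) ≡ sgn i
sgn-neg i = cong ((- 1ℚ) ^_) (ℤₚ.∣-i∣≡∣i∣ i)

sgn-suc : ∀ i → sgn (i ℤ.+ + 1) ≡ - 1ℚ * sgn i
sgn-suc (+ n)          = cong ((- 1ℚ) ^_) (ℕₚ.+-comm n 1)
sgn-suc -[1+ zero ]    = refl
sgn-suc -[1+ suc n ]   = x≡-1*[-1*x] ((- 1ℚ) ^ suc n)

sgn-pred : ∀ i → sgn (i ℤ.- + 1) ≡ - 1ℚ * sgn i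
sgn-pred i = begin
  sgn (i ℤ.- + 1)                       ≡⟨ x≡-1*[-1*x] (sgn (i ℤ.- + 1)) ⟩
  - 1ℚ * (- 1ℚ * sgn (i ℤ.- + 1))       ≡⟨ cong (- 1ℚ *_) (sgn-suc (i ℤ.- + 1)) ⟨
  - 1ℚ * sgn (i ℤ.- + 1 ℤ.+ + 1)        ≡⟨ cong (λ k → - 1ℚ * sgn k) (k-1+1 i) ⟩
  - 1ℚ * sgn i                          ∎
  where
  open ≡-Reasoning
  k-1+1 : ∀ k → k ℤ.- + 1 ℤ.+ + 1 ≡ k
  k-1+1 = ℤ-Solver.solve-∀

-- The summand

binomTerm : ℚ → ℕ → ℤ → ℚ
binomTerm q n k = q ^ℤ (k ℤ.* k) * gbin (q ^ 2) (+ n ℤ.- k) (+ n ℤ.+ k)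

summand : ℚ → ℕ → ℕ → ℤ → ℤ → ℚ
summand q L M i j = sgn i * binomTerm q L i * binomTerm q M j * (q ^ 2) ^ℤ (i ℤ.* j)

module _ {q : ℚ} (q≢0 : q ≢ 0ℚ) (q²^suc≢1 : ∀ m → (q ^ 2) ^ suc m ≢ 1ℚ) where

  private
    q²≢0 : q ^ 2 ≢ 0ℚ
    q²≢0 = ^-≢0 q≢0 2

    c : ℕ → ℤ → ℚ
    c = binomTerm q

    w : ℤ → ℚ
    w k = (q ^ 2) ^ℤ k

  w-+ : ∀ k l → w (k ℤ.+ l) ≡ w k * w l
  w-+ = ^ℤ-+ q²≢0

  w-inverse : ∀ k → w k * w (ℤ.- k) ≡ 1ℚ
  w-inverse = ^ℤ-inverse q²≢0

  ^ℤ-square : ∀ k → q ^ℤ k * q ^ℤ k ≡ w k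
  ^ℤ-square k = trans (sym (^ℤ-+ q≢0 k k)) (sym (²-^ℤ q k))

  w≢1 : ∀ {k} → k ≢ + 0 → w k ≢ 1ℚ
  w≢1 {+ zero}    k≢0 _   = k≢0 refl
  w≢1 {+ suc m}   _       = q²^suc≢1 m
  w≢1 { -[1+ m ]} _   w≡1 = q²^suc≢1 m (trans (sym (inv-involutive _)) (cong inv w≡1))

  ^ℤ≢1 : ∀ {k} → k ≢ + 0 → q ^ℤ k ≢ 1ℚ
  ^ℤ≢1 {k} k≢0 qᵏ≡1 = w≢1 k≢0 (trans (sym (^ℤ-square k)) (cong₂ _*_ qᵏ≡1 qᵏ≡1))

  ^ℤ≢-1 : ∀ k → q ^ℤ k ≢ - 1ℚ
  ^ℤ≢-1 (+ zero) ()
  ^ℤ≢-1 k@(+ suc m)  qᵏ≡-1 = w≢1 {k} (λ ()) (trans (sym (^ℤ-square k)) (cong₂ _*_ qᵏ≡-1 qᵏ≡-1))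
  ^ℤ≢-1 k@(-[1+ m ]) qᵏ≡-1 = w≢1 {k} (λ ()) (trans (sym (^ℤ-square k)) (cong₂ _*_ qᵏ≡-1 qᵏ≡-1))

  ^ℤ-injective : ∀ {k l} → q ^ℤ k ≡ q ^ℤ l → k ≡ l
  ^ℤ-injective {k} {l} qᵏ≡qˡ with k ℤ.- l ℤ.≟ + 0
  ... | yes k-l≡0 = ℤₚ.i-j≡0⇒i≡j k l k-l≡0
  ... | no  k-l≢0 = ⊥-elim (^ℤ≢1 k-l≢0 (begin
    q ^ℤ (k ℤ.- l)            ≡⟨ ^ℤ-+ q≢0 k (ℤ.- l) ⟩
    q ^ℤ k * q ^ℤ (ℤ.- l)     ≡⟨ cong (_* q ^ℤ (ℤ.- l)) qᵏ≡qˡ ⟩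
    q ^ℤ l * q ^ℤ (ℤ.- l)     ≡⟨ ^ℤ-inverse q≢0 l ⟩
    1ℚ                        ∎))
    where open ≡-Reasoning

  q*w≡^ℤ : ∀ k → q * w k ≡ q ^ℤ (+ 1 ℤ.+ (k ℤ.+ k))
  q*w≡^ℤ k = sym (trans (^ℤ-suc q≢0 (k ℤ.+ k)) (cong (q *_) (sym (²-^ℤ q k))))

  x-qy≢0 : ∀ L M → w (+ L) - q * w (+ M) ≢ 0ℚ
  x-qy≢0 L M x-qy≡0 = ℕₚ.even≢odd L M (begin
    2 ℕ.* L                ≡⟨ cong (L ℕ.+_) (ℕₚ.+-identityʳ L) ⟩
    L ℕ.+ L                ≡⟨ ℤₚ.+-injective (^ℤ-injective qᴸ⁺ᴸ≡q²ᴹ⁺¹) ⟩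
    suc (M ℕ.+ M)          ≡⟨ cong (λ m → suc (M ℕ.+ m)) (ℕₚ.+-identityʳ M) ⟨
    suc (2 ℕ.* M)          ∎)
    where
    open ≡-Reasoning
    qᴸ⁺ᴸ≡q²ᴹ⁺¹ : q ^ℤ (+ (L ℕ.+ L)) ≡ q ^ℤ (+ suc (M ℕ.+ M))
    qᴸ⁺ᴸ≡q²ᴹ⁺¹ = trans (sym (²-^ℤ q (+ L))) (trans (x∙y⁻¹≈ε⇒x≈y _ _ x-qy≡0) (q*w≡^ℤ (+ M)))

  ^ℤ-odd : ∀ m k → q ^ℤ (m ℤ.+ (+ 1 ℤ.+ (k ℤ.+ k))) ≡ q ^ℤ m * (q * w k)
  ^ℤ-odd m k = trans (^ℤ-+ q≢0 m _) (cong (q ^ℤ m *_) (sym (q*w≡^ℤ k)))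

  binomTerm-neg : ∀ n k → c n (ℤ.- k) ≡ c n k
  binomTerm-neg n k = cong₂ _*_ (cong (q ^ℤ_) (neg-square k))
    (trans (cong₂ (gbin (q ^ 2)) (n-[-k] (+ n) k) (n+[-k] (+ n) k)) (gbin-sym q²^suc≢1 (+ n ℤ.+ k) (+ n ℤ.- k)))
    where
    neg-square : ∀ k → (ℤ.- k) ℤ.* (ℤ.- k) ≡ k ℤ.* k
    neg-square = ℤ-Solver.solve-∀
    n-[-k] : ∀ n k → n ℤ.- (ℤ.- k) ≡ n ℤ.+ k
    n-[-k] = ℤ-Solver.solve-∀
    n+[-k] : ∀ n k → n ℤ.+ (ℤ.- k) ≡ n ℤ.- k
    n+[-k] = ℤ-Solver.solve-∀

  binomTerm-vanishes : ∀ n → VanishesBeyond n (c n)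
  binomTerm-vanishes n (+ m) n<m with ℕₚ.m≤n⇒∃[o]m+o≡n n<m
  ... | d , refl = trans (cong (λ a → q ^ℤ (k ℤ.* k) * gbin (q ^ 2) a (+ n ℤ.+ k)) (n-[1+n+d] (+ n) (+ d)))
                         (*-zeroʳ (q ^ℤ (k ℤ.* k)))
    where
    k = + suc (n ℕ.+ d)
    n-[1+n+d] : ∀ n d → n ℤ.- (+ 1 ℤ.+ (n ℤ.+ d)) ≡ ℤ.- (+ 1 ℤ.+ d)
    n-[1+n+d] = ℤ-Solver.solve-∀
  binomTerm-vanishes n -[1+ m ] n<m = trans (binomTerm-neg n (+ suc m)) (binomTerm-vanishes n (+ suc m) n<m)

  binomTerm-ratio : ∀ n k →
    c n (k ℤ.+ + 1) * (1ℚ - w (+ n ℤ.+ (k ℤ.+ + 1))) ≡ (q * w k) * ((1ℚ - w (+ n ℤ.- k)) * c n k)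
  binomTerm-ratio n k = begin
    q ^ℤ ((k ℤ.+ + 1) ℤ.* (k ℤ.+ + 1)) * G′ * (1ℚ - w (+ n ℤ.+ (k ℤ.+ + 1)))
      ≡⟨ cong (λ z → z * G′ * (1ℚ - w (+ n ℤ.+ (k ℤ.+ + 1)))) (trans (cong (q ^ℤ_) ([k+1]² k)) (^ℤ-odd (k ℤ.* k) k)) ⟩
    q ^ℤ (k ℤ.* k) * (q * w k) * G′ * (1ℚ - w (+ n ℤ.+ (k ℤ.+ + 1)))
      ≡⟨ regroup (q ^ℤ (k ℤ.* k)) (q * w k) G′ (1ℚ - w (+ n ℤ.+ (k ℤ.+ + 1))) ⟩
    q ^ℤ (k ℤ.* k) * (q * w k) * (G′ * (1ℚ - w (+ n ℤ.+ (k ℤ.+ + 1))))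
      ≡⟨ cong (λ z → q ^ℤ (k ℤ.* k) * (q * w k) * z) gbin-ratio′ ⟨
    q ^ℤ (k ℤ.* k) * (q * w k) * (G * (1ℚ - w (+ n ℤ.- k)))
      ≡⟨ regroup′ (q ^ℤ (k ℤ.* k)) (q * w k) G (1ℚ - w (+ n ℤ.- k)) ⟩
    (q * w k) * ((1ℚ - w (+ n ℤ.- k)) * c n k) ∎
    where
    open ≡-Reasoning
    G  = gbin (q ^ 2) (+ n ℤ.- k) (+ n ℤ.+ k)
    G′ = gbin (q ^ 2) (+ n ℤ.- (k ℤ.+ + 1)) (+ n ℤ.+ (k ℤ.+ + 1))
    [k+1]² : ∀ k → (k ℤ.+ + 1) ℤ.* (k ℤ.+ + 1) ≡ k ℤ.* k ℤ.+ (+ 1 ℤ.+ (k ℤ.+ k))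
    [k+1]² = ℤ-Solver.solve-∀
    1+[n-[k+1]] : ∀ n k → + 1 ℤ.+ (n ℤ.- (k ℤ.+ + 1)) ≡ n ℤ.- k
    1+[n-[k+1]] = ℤ-Solver.solve-∀
    1+[n+k] : ∀ n k → + 1 ℤ.+ (n ℤ.+ k) ≡ n ℤ.+ (k ℤ.+ + 1)
    1+[n+k] = ℤ-Solver.solve-∀
    gbin-ratio′ : G * (1ℚ - w (+ n ℤ.- k)) ≡ G′ * (1ℚ - w (+ n ℤ.+ (k ℤ.+ + 1)))
    gbin-ratio′ = subst₂ (λ u v → gbin (q ^ 2) u (+ n ℤ.+ k) * (1ℚ - w u) ≡ gbin (q ^ 2) (+ n ℤ.- (k ℤ.+ + 1)) v * (1ℚ - w v))
                         (1+[n-[k+1]] (+ n) k) (1+[n+k] (+ n) k) (gbin-ratio q²^suc≢1 (+ n ℤ.- (k ℤ.+ + 1)) (+ n ℤ.+ k))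
    regroup : ∀ a b c d → a * b * c * d ≡ a * b * (c * d)
    regroup = solve-∀ ℚ-ring
    regroup′ : ∀ a b c d → a * b * (c * d) ≡ b * (d * (a * c))
    regroup′ = solve-∀ ℚ-ring

  private
    Gₙ : ℕ → ℤ → ℚ
    Gₙ n k = gbin (q ^ 2) (+ n ℤ.- k) (+ n ℤ.+ k)

  gbin-three-termₙₖ : ∀ n k → Gₙ (suc n) k ≡
    (1ℚ + w (+ n ℤ.- (k ℤ.- + 1)) * w (+ n ℤ.+ k)) * Gₙ n k
    + w (+ n ℤ.- (k ℤ.- + 1)) * Gₙ n (k ℤ.- + 1) + w (+ n ℤ.+ (k ℤ.+ + 1)) * Gₙ n (k ℤ.+ + 1)
  gbin-three-termₙₖ n k =
    reindex (idx₁ N k) (idx₂ N k) (idx₃ N k) (idx₄ N k) (idx₅ N k) (idx₆ N k) (idx₇ N k) (idx₈ N k)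
    where
    G = gbin (q ^ 2)
    N = + n
    a = N ℤ.- k ℤ.- + 1
    b = N ℤ.+ k ℤ.- + 1
    0≤a+b+2 : + 0 ℤ.≤ (a ℤ.+ b) ℤ.+ + 2
    0≤a+b+2 = subst (λ z → + 0 ℤ.≤ z) (sym (a+b+2 N k)) (ℤ.+≤+ z≤n)
      where a+b+2 : ∀ N k → (N ℤ.- k ℤ.- + 1) ℤ.+ (N ℤ.+ k ℤ.- + 1) ℤ.+ + 2 ≡ N ℤ.+ N
            a+b+2 = ℤ-Solver.solve-∀
    A1 = + 1 ℤ.+ a
    A2 = + 1 ℤ.+ A1
    B1 = + 1 ℤ.+ b
    B2 = + 1 ℤ.+ B1
    reindex : ∀ {u₁ u₂ u₃ u₄ u₅ u₆ u₇ u₈} →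
      A2 ≡ u₁ → B2 ≡ u₂ → A2 ≡ u₃ → b ≡ u₄ → a ≡ u₅ → B2 ≡ u₆ → A1 ≡ u₇ → B1 ≡ u₈ →
      G u₁ u₂ ≡ (1ℚ + w u₃ * w u₈) * G u₇ u₈ + w u₃ * G u₃ u₄ + w u₆ * G u₅ u₆
    reindex refl refl refl refl refl refl refl refl = gbin-three-term q²^suc≢1 a b 0≤a+b+2
    idx₁ : ∀ N k → + 1 ℤ.+ (+ 1 ℤ.+ (N ℤ.- k ℤ.- + 1)) ≡ (+ 1 ℤ.+ N) ℤ.- k
    idx₁ = ℤ-Solver.solve-∀
    idx₂ : ∀ N k → + 1 ℤ.+ (+ 1 ℤ.+ (N ℤ.+ k ℤ.- + 1)) ≡ (+ 1 ℤ.+ N) ℤ.+ k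
    idx₂ = ℤ-Solver.solve-∀
    idx₃ : ∀ N k → + 1 ℤ.+ (+ 1 ℤ.+ (N ℤ.- k ℤ.- + 1)) ≡ N ℤ.- (k ℤ.- + 1)
    idx₃ = ℤ-Solver.solve-∀
    idx₄ : ∀ N k → N ℤ.+ k ℤ.- + 1 ≡ N ℤ.+ (k ℤ.- + 1)
    idx₄ = ℤ-Solver.solve-∀
    idx₅ : ∀ N k → N ℤ.- k ℤ.- + 1 ≡ N ℤ.- (k ℤ.+ + 1)
    idx₅ = ℤ-Solver.solve-∀
    idx₆ : ∀ N k → + 1 ℤ.+ (+ 1 ℤ.+ (N ℤ.+ k ℤ.- + 1)) ≡ N ℤ.+ (k ℤ.+ + 1)
    idx₆ = ℤ-Solver.solve-∀
    idx₇ : ∀ N k → + 1 ℤ.+ (N ℤ.- k ℤ.- + 1) ≡ N ℤ.- k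
    idx₇ = ℤ-Solver.solve-∀
    idx₈ : ∀ N k → + 1 ℤ.+ (N ℤ.+ k ℤ.- + 1) ≡ N ℤ.+ k
    idx₈ = ℤ-Solver.solve-∀

  binomTerm-recurrence : ∀ n k → c (suc n) k ≡
    (1ℚ + (q * q) * (w (+ n) * w (+ n))) * c n k + (q * w (+ n)) * (c n (k ℤ.- + 1) + c n (k ℤ.+ + 1))
  binomTerm-recurrence n k = begin
    qᵏ² * Gₙ (suc n) k
      ≡⟨ cong (qᵏ² *_) (gbin-three-termₙₖ n k) ⟩
    qᵏ² * ((1ℚ + w⁻ * w (N ℤ.+ k)) * Gₙ n k + w⁻ * Gₙ n (k ℤ.- + 1) + w⁺ * Gₙ n (k ℤ.+ + 1))
      ≡⟨ distribute qᵏ² (w⁻ * w (N ℤ.+ k)) (Gₙ n k) w⁻ (Gₙ n (k ℤ.- + 1)) w⁺ (Gₙ n (k ℤ.+ + 1)) ⟩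
    (1ℚ + w⁻ * w (N ℤ.+ k)) * c n k + (qᵏ² * w⁻) * Gₙ n (k ℤ.- + 1) + (qᵏ² * w⁺) * Gₙ n (k ℤ.+ + 1)
      ≡⟨ cong₃ (λ u v t → (1ℚ + u) * c n k + v * Gₙ n (k ℤ.- + 1) + t * Gₙ n (k ℤ.+ + 1)) w⁻*wₙ₊ₖ qᵏ²*w⁻ qᵏ²*w⁺ ⟩
    (1ℚ + (q * q) * (y * y)) * c n k + (q⁻ * (q * y)) * Gₙ n (k ℤ.- + 1) + (q⁺ * (q * y)) * Gₙ n (k ℤ.+ + 1)
      ≡⟨ collect (1ℚ + (q * q) * (y * y)) (c n k) q⁻ (q * y) (Gₙ n (k ℤ.- + 1)) q⁺ (Gₙ n (k ℤ.+ + 1)) ⟩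
    (1ℚ + (q * q) * (y * y)) * c n k + (q * y) * (c n (k ℤ.- + 1) + c n (k ℤ.+ + 1)) ∎
    where
    open ≡-Reasoning
    N = + n
    y = w N
    qᵏ² = q ^ℤ (k ℤ.* k)
    q⁻ = q ^ℤ ((k ℤ.- + 1) ℤ.* (k ℤ.- + 1))
    q⁺ = q ^ℤ ((k ℤ.+ + 1) ℤ.* (k ℤ.+ + 1))
    u⁻ = N ℤ.- (k ℤ.- + 1)
    u⁺ = N ℤ.+ (k ℤ.+ + 1)
    w⁻ = w u⁻
    w⁺ = w u⁺
    cong₃ : ∀ {x x′ y y′ z z′ : ℚ} (f : ℚ → ℚ → ℚ → ℚ) → x ≡ x′ → y ≡ y′ → z ≡ z′ → f x y z ≡ f x′ y′ z′
    cong₃ f refl refl refl = refl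
    exponent⁻ : ∀ N k → k ℤ.* k ℤ.+ ((N ℤ.- (k ℤ.- + 1)) ℤ.+ (N ℤ.- (k ℤ.- + 1)))
                      ≡ (k ℤ.- + 1) ℤ.* (k ℤ.- + 1) ℤ.+ (+ 1 ℤ.+ (N ℤ.+ N))
    exponent⁻ = ℤ-Solver.solve-∀
    exponent⁺ : ∀ N k → k ℤ.* k ℤ.+ ((N ℤ.+ (k ℤ.+ + 1)) ℤ.+ (N ℤ.+ (k ℤ.+ + 1)))
                      ≡ (k ℤ.+ + 1) ℤ.* (k ℤ.+ + 1) ℤ.+ (+ 1 ℤ.+ (N ℤ.+ N))
    exponent⁺ = ℤ-Solver.solve-∀
    exponent-sum : ∀ N k → (N ℤ.- (k ℤ.- + 1)) ℤ.+ (N ℤ.+ k) ≡ + 1 ℤ.+ (N ℤ.+ N)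
    exponent-sum = ℤ-Solver.solve-∀
    qᵏ²*w⁻ : qᵏ² * w⁻ ≡ q⁻ * (q * y)
    qᵏ²*w⁻ = trans (trans (cong (qᵏ² *_) (²-^ℤ q u⁻)) (sym (^ℤ-+ q≢0 (k ℤ.* k) (u⁻ ℤ.+ u⁻))))
                   (trans (cong (q ^ℤ_) (exponent⁻ N k)) (^ℤ-odd ((k ℤ.- + 1) ℤ.* (k ℤ.- + 1)) N))
    qᵏ²*w⁺ : qᵏ² * w⁺ ≡ q⁺ * (q * y)
    qᵏ²*w⁺ = trans (trans (cong (qᵏ² *_) (²-^ℤ q u⁺)) (sym (^ℤ-+ q≢0 (k ℤ.* k) (u⁺ ℤ.+ u⁺))))
                   (trans (cong (q ^ℤ_) (exponent⁺ N k)) (^ℤ-odd ((k ℤ.+ + 1) ℤ.* (k ℤ.+ + 1)) N))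
    w⁻*wₙ₊ₖ : w⁻ * w (N ℤ.+ k) ≡ (q * q) * (y * y)
    w⁻*wₙ₊ₖ = trans (sym (w-+ u⁻ (N ℤ.+ k)))
                    (trans (cong w (exponent-sum N k)) (trans (w-+ (+ 1) (N ℤ.+ N)) (cong₂ _*_ (w₁ q) (w-+ N N))))
      where w₁ : ∀ q → (q * (q * 1ℚ)) * 1ℚ ≡ q * q
            w₁ = solve-∀ ℚ-ring
    distribute : ∀ Z v G₀ a g₁ b g₂ → Z * ((1ℚ + v) * G₀ + a * g₁ + b * g₂)
               ≡ (1ℚ + v) * (Z * G₀) + (Z * a) * g₁ + (Z * b) * g₂
    distribute = solve-∀ ℚ-ring
    collect : ∀ v c₀ Z₋ qy b₋ Z₊ b₊ → v * c₀ + (Z₋ * qy) * b₋ + (Z₊ * qy) * b₊ ≡ v * c₀ + qy * (Z₋ * b₋ + Z₊ * b₊)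
    collect = solve-∀ ℚ-ring

  private
    F : ℕ → ℕ → ℤ → ℤ → ℚ
    F = summand q

  summand-vanishes : ∀ L M → VanishesOutside L M (F L M)
  summand-vanishes L M i j (inj₁ L<∣i∣) =
    trans (cong (λ z → sgn i * z * c M j * w (i ℤ.* j)) (binomTerm-vanishes L i L<∣i∣)) (zero-factor (sgn i) (c M j) (w (i ℤ.* j)))
    where zero-factor : ∀ a b d → a * 0ℚ * b * d ≡ 0ℚ
          zero-factor = solve-∀ ℚ-ring
  summand-vanishes L M i j (inj₂ M<∣j∣) =
    trans (cong (λ z → sgn i * c L i * z * w (i ℤ.* j)) (binomTerm-vanishes M j M<∣j∣)) (zero-factor (sgn i * c L i) (w (i ℤ.* j)))
    where zero-factor : ∀ a d → a * 0ℚ * d ≡ 0ℚ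
          zero-factor = solve-∀ ℚ-ring

  lhsTerm≡summand : ∀ L M i j → lhsTerm q L M i j ≡ F L M i j
  lhsTerm≡summand L M i j = begin
    sgn i * q ^ℤ (+ (∣ i ℤ.+ j ∣ ℕ.* ∣ i ℤ.+ j ∣)) * c′ L i * c′ M j
      ≡⟨ cong (λ z → sgn i * z * c′ L i * c′ M j) q^[i+j]² ⟩
    sgn i * (q ^ℤ (i ℤ.* i) * (q ^ℤ (j ℤ.* j) * w (i ℤ.* j))) * c′ L i * c′ M j
      ≡⟨ regroup (sgn i) (q ^ℤ (i ℤ.* i)) (q ^ℤ (j ℤ.* j)) (w (i ℤ.* j)) (c′ L i) (c′ M j) ⟩
    F L M i j ∎
    where
    open ≡-Reasoning
    c′ : ℕ → ℤ → ℚ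
    c′ n k = gbin (q ^ 2) (+ n ℤ.- k) (+ n ℤ.+ k)
    k*k≡∣k∣*∣k∣ : ∀ k → k ℤ.* k ≡ + (∣ k ∣ ℕ.* ∣ k ∣)
    k*k≡∣k∣*∣k∣ (+ n)    = ℤₚ.+◃n≡+n (n ℕ.* n)
    k*k≡∣k∣*∣k∣ -[1+ n ] = ℤₚ.+◃n≡+n (suc n ℕ.* suc n)
    [i+j]² : ∀ i j → (i ℤ.+ j) ℤ.* (i ℤ.+ j) ≡ i ℤ.* i ℤ.+ (j ℤ.* j ℤ.+ (i ℤ.* j ℤ.+ i ℤ.* j))
    [i+j]² = ℤ-Solver.solve-∀
    q^[i+j]² : q ^ℤ (+ (∣ i ℤ.+ j ∣ ℕ.* ∣ i ℤ.+ j ∣)) ≡ q ^ℤ (i ℤ.* i) * (q ^ℤ (j ℤ.* j) * w (i ℤ.* j))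
    q^[i+j]² = begin
      q ^ℤ (+ (∣ i ℤ.+ j ∣ ℕ.* ∣ i ℤ.+ j ∣))                    ≡⟨ cong (q ^ℤ_) (trans (sym (k*k≡∣k∣*∣k∣ (i ℤ.+ j))) ([i+j]² i j)) ⟩
      q ^ℤ (i ℤ.* i ℤ.+ (j ℤ.* j ℤ.+ (i ℤ.* j ℤ.+ i ℤ.* j)))   ≡⟨ ^ℤ-+ q≢0 (i ℤ.* i) _ ⟩
      q ^ℤ (i ℤ.* i) * q ^ℤ (j ℤ.* j ℤ.+ (i ℤ.* j ℤ.+ i ℤ.* j)) ≡⟨ cong (q ^ℤ (i ℤ.* i) *_) (^ℤ-+ q≢0 (j ℤ.* j) _) ⟩
      q ^ℤ (i ℤ.* i) * (q ^ℤ (j ℤ.* j) * q ^ℤ (i ℤ.* j ℤ.+ i ℤ.* j)) ≡⟨ cong (λ z → q ^ℤ (i ℤ.* i) * (q ^ℤ (j ℤ.* j) * z)) (sym (²-^ℤ q (i ℤ.* j))) ⟩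
      q ^ℤ (i ℤ.* i) * (q ^ℤ (j ℤ.* j) * w (i ℤ.* j))           ∎
    regroup : ∀ s a b e B₁ B₂ → s * (a * (b * e)) * B₁ * B₂ ≡ s * (a * B₁) * (b * B₂) * e
    regroup = solve-∀ ℚ-ring

  summand-reflect : ∀ L M i j → F L M (ℤ.- i) (ℤ.- j) ≡ F L M i j
  summand-reflect L M i j =
    cong₂ _*_ (cong₂ _*_ (cong₂ _*_ (sgn-neg i) (binomTerm-neg L i)) (binomTerm-neg M j)) (cong w (neg*neg i j))
    where
    neg*neg : ∀ i j → (ℤ.- i) ℤ.* (ℤ.- j) ≡ i ℤ.* j
    neg*neg = ℤ-Solver.solve-∀

  summand-shiftʲ : ∀ L M i j →
    F L M i (j ℤ.+ + 1) * (1ℚ - w (+ M ℤ.+ (j ℤ.+ + 1))) ≡ (q * w i * w j) * ((1ℚ - w (+ M ℤ.- j)) * F L M i j)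
  summand-shiftʲ L M i j = begin
    sgn i * c L i * c M (j ℤ.+ + 1) * w (i ℤ.* (j ℤ.+ + 1)) * u
      ≡⟨ cong (λ z → sgn i * c L i * c M (j ℤ.+ + 1) * z * u) (trans (cong w (i*[j+1] i j)) (w-+ (i ℤ.* j) i)) ⟩
    sgn i * c L i * c M (j ℤ.+ + 1) * (w (i ℤ.* j) * w i) * u
      ≡⟨ regroup (sgn i * c L i) (c M (j ℤ.+ + 1)) (w (i ℤ.* j)) (w i) u ⟩
    (sgn i * c L i) * (w (i ℤ.* j) * w i) * (c M (j ℤ.+ + 1) * u)
      ≡⟨ cong ((sgn i * c L i) * (w (i ℤ.* j) * w i) *_) (binomTerm-ratio M j) ⟩
    (sgn i * c L i) * (w (i ℤ.* j) * w i) * ((q * w j) * ((1ℚ - w (+ M ℤ.- j)) * c M j))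
      ≡⟨ regroup′ (sgn i * c L i) (w (i ℤ.* j)) (w i) q (w j) (1ℚ - w (+ M ℤ.- j)) (c M j) ⟩
    (q * w i * w j) * ((1ℚ - w (+ M ℤ.- j)) * F L M i j) ∎
    where
    open ≡-Reasoning
    u = 1ℚ - w (+ M ℤ.+ (j ℤ.+ + 1))
    i*[j+1] : ∀ i j → i ℤ.* (j ℤ.+ + 1) ≡ i ℤ.* j ℤ.+ i
    i*[j+1] = ℤ-Solver.solve-∀
    regroup : ∀ s c₁ e wi u → s * c₁ * (e * wi) * u ≡ s * (e * wi) * (c₁ * u)
    regroup = solve-∀ ℚ-ring
    regroup′ : ∀ s e wi q wj v cj → s * (e * wi) * ((q * wj) * (v * cj)) ≡ (q * wi * wj) * (v * (s * cj * e))
    regroup′ = solve-∀ ℚ-ring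

  summand-shiftⁱ : ∀ L M i j →
    F L M (i ℤ.+ + 1) j * (1ℚ - w (+ L ℤ.+ (i ℤ.+ + 1))) ≡ - 1ℚ * ((q * w i * w j) * ((1ℚ - w (+ L ℤ.- i)) * F L M i j))
  summand-shiftⁱ L M i j = begin
    sgn (i ℤ.+ + 1) * c L (i ℤ.+ + 1) * c M j * w ((i ℤ.+ + 1) ℤ.* j) * u
      ≡⟨ cong₂ (λ s e → s * c L (i ℤ.+ + 1) * c M j * e * u) (sgn-suc i) (trans (cong w ([i+1]*j i j)) (w-+ (i ℤ.* j) j)) ⟩
    - 1ℚ * sgn i * c L (i ℤ.+ + 1) * c M j * (w (i ℤ.* j) * w j) * u
      ≡⟨ regroup (- 1ℚ * sgn i) (c L (i ℤ.+ + 1)) (c M j) (w (i ℤ.* j) * w j) u ⟩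
    (- 1ℚ * sgn i) * (c M j * (w (i ℤ.* j) * w j)) * (c L (i ℤ.+ + 1) * u)
      ≡⟨ cong ((- 1ℚ * sgn i) * (c M j * (w (i ℤ.* j) * w j)) *_) (binomTerm-ratio L i) ⟩
    (- 1ℚ * sgn i) * (c M j * (w (i ℤ.* j) * w j)) * ((q * w i) * ((1ℚ - w (+ L ℤ.- i)) * c L i))
      ≡⟨ regroup′ (sgn i) (c M j) (w (i ℤ.* j)) (w j) q (w i) (1ℚ - w (+ L ℤ.- i)) (c L i) ⟩
    - 1ℚ * ((q * w i * w j) * ((1ℚ - w (+ L ℤ.- i)) * F L M i j)) ∎
    where
    open ≡-Reasoning
    u = 1ℚ - w (+ L ℤ.+ (i ℤ.+ + 1))
    [i+1]*j : ∀ i j → (i ℤ.+ + 1) ℤ.* j ≡ i ℤ.* j ℤ.+ j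
    [i+1]*j = ℤ-Solver.solve-∀
    regroup : ∀ s a b e u → s * a * b * e * u ≡ s * (b * e) * (a * u)
    regroup = solve-∀ ℚ-ring
    regroup′ : ∀ s cj e wj q wi v ci →
      (- 1ℚ * s) * (cj * (e * wj)) * ((q * wi) * (v * ci)) ≡ - 1ℚ * ((q * wi * wj) * (v * (s * ci * cj * e)))
    regroup′ = solve-∀ ℚ-ring

  summand-recurrenceᴹ : ∀ L M i j → F L (suc M) i j ≡ (1ℚ + (q * q) * (w (+ M) * w (+ M))) * F L M i j
    + (q * w (+ M)) * (w i * F L M i (j ℤ.- + 1) + w (ℤ.- i) * F L M i (j ℤ.+ + 1))
  summand-recurrenceᴹ L M i j = begin
    s * cL * c (suc M) j * e
      ≡⟨ cong (λ z → s * cL * z * e) (binomTerm-recurrence M j) ⟩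
    s * cL * ((1ℚ + v) * c M j + qy * (c₋ + c₊)) * e
      ≡⟨ expand s cL v (c M j) qy c₋ c₊ e ⟩
    (1ℚ + v) * (s * cL * c M j * e) + qy * (s * cL * c₋ * e) + qy * (s * cL * c₊ * e)
      ≡⟨ cong₂ (λ a b → (1ℚ + v) * (s * cL * c M j * e) + qy * (s * cL * c₋ * a) + qy * (s * cL * c₊ * b)) e≡e₋*wi e≡e₊*w-i ⟩
    (1ℚ + v) * (s * cL * c M j * e) + qy * (s * cL * c₋ * (e₋ * w i)) + qy * (s * cL * c₊ * (e₊ * w (ℤ.- i)))
      ≡⟨ collect (1ℚ + v) (s * cL * c M j * e) qy s cL c₋ e₋ (w i) c₊ e₊ (w (ℤ.- i)) ⟩
    (1ℚ + v) * F L M i j + qy * (w i * F L M i (j ℤ.- + 1) + w (ℤ.- i) * F L M i (j ℤ.+ + 1)) ∎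
    where
    open ≡-Reasoning
    s = sgn i
    cL = c L i
    v = (q * q) * (w (+ M) * w (+ M))
    qy = q * w (+ M)
    c₋ = c M (j ℤ.- + 1)
    c₊ = c M (j ℤ.+ + 1)
    e = w (i ℤ.* j)
    e₋ = w (i ℤ.* (j ℤ.- + 1))
    e₊ = w (i ℤ.* (j ℤ.+ + 1))
    idx₋ : ∀ i j → i ℤ.* j ≡ i ℤ.* (j ℤ.- + 1) ℤ.+ i
    idx₋ = ℤ-Solver.solve-∀
    idx₊ : ∀ i j → i ℤ.* j ≡ i ℤ.* (j ℤ.+ + 1) ℤ.+ ℤ.- i
    idx₊ = ℤ-Solver.solve-∀
    e≡e₋*wi : e ≡ e₋ * w i
    e≡e₋*wi = trans (cong w (idx₋ i j)) (w-+ (i ℤ.* (j ℤ.- + 1)) i)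
    e≡e₊*w-i : e ≡ e₊ * w (ℤ.- i)
    e≡e₊*w-i = trans (cong w (idx₊ i j)) (w-+ (i ℤ.* (j ℤ.+ + 1)) (ℤ.- i))
    expand : ∀ s cL v cj qy c₋ c₊ e → s * cL * ((1ℚ + v) * cj + qy * (c₋ + c₊)) * e
           ≡ (1ℚ + v) * (s * cL * cj * e) + qy * (s * cL * c₋ * e) + qy * (s * cL * c₊ * e)
    expand = solve-∀ ℚ-ring
    collect : ∀ a A qy s cL c₋ e₋ wi c₊ e₊ w-i → a * A + qy * (s * cL * c₋ * (e₋ * wi)) + qy * (s * cL * c₊ * (e₊ * w-i))
            ≡ a * A + qy * (wi * (s * cL * c₋ * e₋) + w-i * (s * cL * c₊ * e₊))
    collect = solve-∀ ℚ-ring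

  summand-recurrenceᴸ : ∀ L M i j → F (suc L) M i j ≡ (1ℚ + (q * q) * (w (+ L) * w (+ L))) * F L M i j
    - (q * w (+ L)) * (w j * F L M (i ℤ.- + 1) j + w (ℤ.- j) * F L M (i ℤ.+ + 1) j)
  summand-recurrenceᴸ L M i j = begin
    s * c (suc L) i * cM * e
      ≡⟨ cong (λ z → s * z * cM * e) (binomTerm-recurrence L i) ⟩
    s * ((1ℚ + v) * c L i + qx * (c₋ + c₊)) * cM * e
      ≡⟨ expand s v (c L i) qx c₋ c₊ cM e ⟩
    (1ℚ + v) * (s * c L i * cM * e) + qx * (s * c₋ * cM * e) + qx * (s * c₊ * cM * e)
      ≡⟨ cong₂ (λ a b → (1ℚ + v) * (s * c L i * cM * e) + qx * (s * c₋ * cM * a) + qx * (s * c₊ * cM * b)) e≡e₋*wj e≡e₊*w-j ⟩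
    (1ℚ + v) * (s * c L i * cM * e) + qx * (s * c₋ * cM * (e₋ * w j)) + qx * (s * c₊ * cM * (e₊ * w (ℤ.- j)))
      ≡⟨ collect (1ℚ + v) (s * c L i * cM * e) qx s c₋ cM e₋ (w j) c₊ e₊ (w (ℤ.- j)) ⟩
    (1ℚ + v) * F L M i j - qx * (w j * ((- 1ℚ * s) * c₋ * cM * e₋) + w (ℤ.- j) * ((- 1ℚ * s) * c₊ * cM * e₊))
      ≡⟨ cong₂ (λ a b → (1ℚ + v) * F L M i j - qx * (w j * (a * c₋ * cM * e₋) + w (ℤ.- j) * (b * c₊ * cM * e₊)))
               (sym (sgn-pred i)) (sym (sgn-suc i)) ⟩
    (1ℚ + v) * F L M i j - qx * (w j * F L M (i ℤ.- + 1) j + w (ℤ.- j) * F L M (i ℤ.+ + 1) j) ∎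
    where
    open ≡-Reasoning
    s = sgn i
    cM = c M j
    v = (q * q) * (w (+ L) * w (+ L))
    qx = q * w (+ L)
    c₋ = c L (i ℤ.- + 1)
    c₊ = c L (i ℤ.+ + 1)
    e = w (i ℤ.* j)
    e₋ = w ((i ℤ.- + 1) ℤ.* j)
    e₊ = w ((i ℤ.+ + 1) ℤ.* j)
    idx₋ : ∀ i j → i ℤ.* j ≡ (i ℤ.- + 1) ℤ.* j ℤ.+ j
    idx₋ = ℤ-Solver.solve-∀
    idx₊ : ∀ i j → i ℤ.* j ≡ (i ℤ.+ + 1) ℤ.* j ℤ.+ ℤ.- j
    idx₊ = ℤ-Solver.solve-∀
    e≡e₋*wj : e ≡ e₋ * w j
    e≡e₋*wj = trans (cong w (idx₋ i j)) (w-+ ((i ℤ.- + 1) ℤ.* j) j)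
    e≡e₊*w-j : e ≡ e₊ * w (ℤ.- j)
    e≡e₊*w-j = trans (cong w (idx₊ i j)) (w-+ ((i ℤ.+ + 1) ℤ.* j) (ℤ.- j))
    expand : ∀ s v ci qx c₋ c₊ cM e → s * ((1ℚ + v) * ci + qx * (c₋ + c₊)) * cM * e
           ≡ (1ℚ + v) * (s * ci * cM * e) + qx * (s * c₋ * cM * e) + qx * (s * c₊ * cM * e)
    expand = solve-∀ ℚ-ring
    collect : ∀ a A qx s c₋ cM e₋ wj c₊ e₊ w-j → a * A + qx * (s * c₋ * cM * (e₋ * wj)) + qx * (s * c₊ * cM * (e₊ * w-j))
            ≡ a * A - qx * (wj * ((- 1ℚ * s) * c₋ * cM * e₋) + w-j * ((- 1ℚ * s) * c₊ * cM * e₊))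
    collect = solve-∀ ℚ-ring

  -- Moments of the summand

  module _ (L M N : ℕ) (L<N : L ℕ.< N) (M<N : M ℕ.< N) where

    private
      f : ℤ → ℤ → ℚ
      f = F L M

      x y : ℚ
      x = w (+ L)
      y = w (+ M)

      moment : (ℤ → ℤ → ℚ) → ℚ
      moment g = doubleSum N (λ i j → f i j * g i j)

      moment-linear : ∀ {U} a b g h → (∀ i j → U i j ≡ a * g i j + b * h i j) →
        moment U ≡ a * moment g + b * moment h
      moment-linear a b g h U≗ = trans
        (doubleSum-cong N (λ i j → trans (cong (f i j *_) (U≗ i j)) (distrib (f i j) a (g i j) b (h i j))))
        (doubleSum-linear N a b (λ i j → f i j * g i j) (λ i j → f i j * h i j))
        where distrib : ∀ f a g b h → f * (a * g + b * h) ≡ a * (f * g) + b * (f * h)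
              distrib = solve-∀ ℚ-ring

      moment-reflect : ∀ (g : ℤ → ℤ → ℚ) → moment (λ i j → g (ℤ.- i) (ℤ.- j)) ≡ moment g
      moment-reflect g = trans
        (doubleSum-cong N (λ i j → cong (_* g (ℤ.- i) (ℤ.- j)) (sym (summand-reflect L M i j))))
        (doubleSum-reflect N (λ i j → f i j * g i j))

      moment-shiftʲ : ∀ (u : ℤ → ℚ) → moment (λ i j → (1ℚ - y * w j) * u i) ≡ moment (λ i j → q * w i * (w j - y) * u i)
      moment-shiftʲ u = begin
        moment (λ i j → (1ℚ - y * w j) * u i)          ≡⟨ doubleSum-cong N (λ i j → trans (cong (λ z → f i j * ((1ℚ - z) * u i)) (sym (w-+ (+ M) j)))
                                                                                    (sym (*-assoc (f i j) _ (u i)))) ⟩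
        doubleSum N U                                  ≡⟨ doubleSum-shiftʲ⁺ U≈0 M<N ⟨
        doubleSum N (λ i j → U i (j ℤ.+ + 1))          ≡⟨ doubleSum-cong N (λ i j → cong (_* u i) (summand-shiftʲ L M i j)) ⟩
        doubleSum N (λ i j → (q * w i * w j) * ((1ℚ - w (+ M ℤ.- j)) * f i j) * u i)
                                                       ≡⟨ doubleSum-cong N pointwise ⟩
        moment (λ i j → q * w i * (w j - y) * u i)     ∎
        where
        open ≡-Reasoning
        U = λ i j → f i j * (1ℚ - w (+ M ℤ.+ j)) * u i
        U≈0 : VanishesOutside L M U
        U≈0 = vanishesOutside-*ʳ (vanishesOutside-*ʳ (summand-vanishes L M) (λ _ j → 1ℚ - w (+ M ℤ.+ j))) (λ i _ → u i)
        regroup : ∀ q wi wj y w-j f u → (q * wi * wj) * ((1ℚ - y * w-j) * f) * u ≡ f * (q * wi * (wj - y * (wj * w-j)) * u)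
        regroup = solve-∀ ℚ-ring
        pointwise : ∀ i j → (q * w i * w j) * ((1ℚ - w (+ M ℤ.- j)) * f i j) * u i ≡ f i j * (q * w i * (w j - y) * u i)
        pointwise i j = trans (cong (λ z → (q * w i * w j) * ((1ℚ - z) * f i j) * u i) (w-+ (+ M) (ℤ.- j)))
          (trans (regroup q (w i) (w j) y (w (ℤ.- j)) (f i j) (u i))
                 (cong (λ z → f i j * (q * w i * (w j - z) * u i)) (trans (cong (y *_) (w-inverse j)) (*-identityʳ y))))

      moment-shiftⁱ : ∀ (u : ℤ → ℚ) → moment (λ i j → (1ℚ - x * w i) * u j) ≡ moment (λ i j → - q * w j * (w i - x) * u j)
      moment-shiftⁱ u = begin
        moment (λ i j → (1ℚ - x * w i) * u j)          ≡⟨ doubleSum-cong N (λ i j → trans (cong (λ z → f i j * ((1ℚ - z) * u j)) (sym (w-+ (+ L) i)))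
                                                                                    (sym (*-assoc (f i j) _ (u j)))) ⟩
        doubleSum N U                                  ≡⟨ doubleSum-shiftⁱ⁺ U≈0 L<N ⟨
        doubleSum N (λ i j → U (i ℤ.+ + 1) j)          ≡⟨ doubleSum-cong N (λ i j → cong (_* u j) (summand-shiftⁱ L M i j)) ⟩
        doubleSum N (λ i j → - 1ℚ * ((q * w i * w j) * ((1ℚ - w (+ L ℤ.- i)) * f i j)) * u j)
                                                       ≡⟨ doubleSum-cong N pointwise ⟩
        moment (λ i j → - q * w j * (w i - x) * u j)   ∎
        where
        open ≡-Reasoning
        U = λ i j → f i j * (1ℚ - w (+ L ℤ.+ i)) * u j
        U≈0 : VanishesOutside L M U
        U≈0 = vanishesOutside-*ʳ (vanishesOutside-*ʳ (summand-vanishes L M) (λ i _ → 1ℚ - w (+ L ℤ.+ i))) (λ _ j → u j)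
        regroup : ∀ q wi wj x w-i f u → - 1ℚ * ((q * wi * wj) * ((1ℚ - x * w-i) * f)) * u ≡ f * (- q * wj * (wi - x * (wi * w-i)) * u)
        regroup = solve-∀ ℚ-ring
        pointwise : ∀ i j → - 1ℚ * ((q * w i * w j) * ((1ℚ - w (+ L ℤ.- i)) * f i j)) * u j ≡ f i j * (- q * w j * (w i - x) * u j)
        pointwise i j = trans (cong (λ z → - 1ℚ * ((q * w i * w j) * ((1ℚ - z) * f i j)) * u j) (w-+ (+ L) (ℤ.- i)))
          (trans (regroup q (w i) (w j) x (w (ℤ.- i)) (f i j) (u j))
                 (cong (λ z → f i j * (- q * w j * (w i - z) * u j)) (trans (cong (x *_) (w-inverse i)) (*-identityʳ x))))

      S A B C D : ℚ
      S = moment (λ _ _ → 1ℚ)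
      A = moment (λ i _ → w i)
      B = moment (λ _ j → w j)
      C = moment (λ i j → w i * w j)
      D = moment (λ i j → w i * w (ℤ.- j))

      A-reflect : moment (λ i _ → w (ℤ.- i)) ≡ A
      A-reflect = moment-reflect (λ i _ → w i)

      B-reflect : moment (λ _ j → w (ℤ.- j)) ≡ B
      B-reflect = moment-reflect (λ _ j → w j)

      D-reflect : moment (λ i j → w (ℤ.- i) * w j) ≡ D
      D-reflect = trans (doubleSum-cong N (λ i j → cong (λ k → f i j * (w (ℤ.- i) * w k)) (sym (ℤₚ.neg-involutive j))))
                        (moment-reflect (λ i j → w i * w (ℤ.- j)))

      weighted : ∀ a b c → a - b * c ≡ 1ℚ * a + (- b) * c
      weighted = solve-∀ ℚ-ring

      unweighted : ∀ a b c d → a * b + (- (a * c)) * d ≡ a * b - a * c * d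
      unweighted = solve-∀ ℚ-ring

      E₁ : S - y * B ≡ q * C - q * y * A
      E₁ = begin
        S - y * B                                   ≡⟨ weighted S y B ⟩
        1ℚ * S + (- y) * B                          ≡⟨ moment-linear 1ℚ (- y) (λ _ _ → 1ℚ) (λ _ j → w j) (λ _ j → split₁ y (w j)) ⟨
        moment (λ i j → (1ℚ - y * w j) * 1ℚ)        ≡⟨ moment-shiftʲ (λ _ → 1ℚ) ⟩
        moment (λ i j → q * w i * (w j - y) * 1ℚ)   ≡⟨ moment-linear q (- (q * y)) (λ i j → w i * w j) (λ i _ → w i) (λ i j → split₂ q (w i) (w j) y) ⟩
        q * C + (- (q * y)) * A                     ≡⟨ unweighted q C y A ⟩
        q * C - q * y * A                           ∎
        where
        open ≡-Reasoning
        split₁ : ∀ y wj → (1ℚ - y * wj) * 1ℚ ≡ 1ℚ * 1ℚ + (- y) * wj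
        split₁ = solve-∀ ℚ-ring
        split₂ : ∀ q wi wj y → q * wi * (wj - y) * 1ℚ ≡ q * (wi * wj) + (- (q * y)) * wi
        split₂ = solve-∀ ℚ-ring

      E₂ : S - x * A ≡ q * x * B - q * C
      E₂ = begin
        S - x * A                                   ≡⟨ weighted S x A ⟩
        1ℚ * S + (- x) * A                          ≡⟨ moment-linear 1ℚ (- x) (λ _ _ → 1ℚ) (λ i _ → w i) (λ i _ → split₁ x (w i)) ⟨
        moment (λ i j → (1ℚ - x * w i) * 1ℚ)        ≡⟨ moment-shiftⁱ (λ _ → 1ℚ) ⟩
        moment (λ i j → - q * w j * (w i - x) * 1ℚ) ≡⟨ moment-linear (q * x) (- q) (λ _ j → w j) (λ i j → w i * w j) (λ i j → split₂ q (w i) (w j) x) ⟩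
        q * x * B + (- q) * C                       ≡⟨ tidy (q * x * B) q C ⟩
        q * x * B - q * C                           ∎
        where
        open ≡-Reasoning
        split₁ : ∀ x wi → (1ℚ - x * wi) * 1ℚ ≡ 1ℚ * 1ℚ + (- x) * wi
        split₁ = solve-∀ ℚ-ring
        split₂ : ∀ q wi wj x → - q * wj * (wi - x) * 1ℚ ≡ q * x * wj + (- q) * (wi * wj)
        split₂ = solve-∀ ℚ-ring
        tidy : ∀ a q c → a + (- q) * c ≡ a - q * c
        tidy = solve-∀ ℚ-ring

      E₃ : A - y * D ≡ q * B - q * y * S
      E₃ = begin
        A - y * D                                   ≡⟨ cong₂ (λ a d → a - y * d) (sym A-reflect) (sym D-reflect) ⟩
        A⁻ - y * D⁻                                 ≡⟨ weighted A⁻ y D⁻ ⟩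
        1ℚ * A⁻ + (- y) * D⁻                        ≡⟨ moment-linear 1ℚ (- y) (λ i _ → w (ℤ.- i)) (λ i j → w (ℤ.- i) * w j)
                                                         (λ i j → split₁ y (w j) (w (ℤ.- i))) ⟨
        moment (λ i j → (1ℚ - y * w j) * w (ℤ.- i)) ≡⟨ moment-shiftʲ (λ i → w (ℤ.- i)) ⟩
        moment (λ i j → q * w i * (w j - y) * w (ℤ.- i))
                                                    ≡⟨ moment-linear q (- (q * y)) (λ _ j → w j) (λ _ _ → 1ℚ) pointwise ⟩
        q * B + (- (q * y)) * S                     ≡⟨ unweighted q B y S ⟩
        q * B - q * y * S                           ∎
        where
        open ≡-Reasoning
        A⁻ = moment (λ i _ → w (ℤ.- i))
        D⁻ = moment (λ i j → w (ℤ.- i) * w j)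
        split₁ : ∀ y wj w-i → (1ℚ - y * wj) * w-i ≡ 1ℚ * w-i + (- y) * (w-i * wj)
        split₁ = solve-∀ ℚ-ring
        split₂ : ∀ q wi wj y w-i → q * wi * (wj - y) * w-i ≡ (q * wj + (- (q * y)) * 1ℚ) * (wi * w-i)
        split₂ = solve-∀ ℚ-ring
        pointwise : ∀ i j → q * w i * (w j - y) * w (ℤ.- i) ≡ q * w j + (- (q * y)) * 1ℚ
        pointwise i j = trans (split₂ q (w i) (w j) y (w (ℤ.- i)))
          (trans (cong ((q * w j + (- (q * y)) * 1ℚ) *_) (w-inverse i)) (*-identityʳ _))

      E₄ : B - x * D ≡ q * x * S - q * A
      E₄ = begin
        B - x * D                                   ≡⟨ cong (λ b → b - x * D) (sym B-reflect) ⟩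
        B⁻ - x * D                                  ≡⟨ weighted B⁻ x D ⟩
        1ℚ * B⁻ + (- x) * D                         ≡⟨ moment-linear 1ℚ (- x) (λ _ j → w (ℤ.- j)) (λ i j → w i * w (ℤ.- j))
                                                         (λ i j → split₁ x (w i) (w (ℤ.- j))) ⟨
        moment (λ i j → (1ℚ - x * w i) * w (ℤ.- j)) ≡⟨ moment-shiftⁱ (λ j → w (ℤ.- j)) ⟩
        moment (λ i j → - q * w j * (w i - x) * w (ℤ.- j))
                                                    ≡⟨ moment-linear (q * x) (- q) (λ _ _ → 1ℚ) (λ i _ → w i) pointwise ⟩
        q * x * S + (- q) * A                       ≡⟨ tidy (q * x * S) q A ⟩
        q * x * S - q * A                           ∎
        where
        open ≡-Reasoning
        B⁻ = moment (λ _ j → w (ℤ.- j))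
        split₁ : ∀ x wi w-j → (1ℚ - x * wi) * w-j ≡ 1ℚ * w-j + (- x) * (wi * w-j)
        split₁ = solve-∀ ℚ-ring
        split₂ : ∀ q wi wj x w-j → - q * wj * (wi - x) * w-j ≡ (q * x * 1ℚ + (- q) * wi) * (wj * w-j)
        split₂ = solve-∀ ℚ-ring
        pointwise : ∀ i j → - q * w j * (w i - x) * w (ℤ.- j) ≡ q * x * 1ℚ + (- q) * w i
        pointwise i j = trans (split₂ q (w i) (w j) x (w (ℤ.- j)))
          (trans (cong ((q * x * 1ℚ + (- q) * w i) *_) (w-inverse j)) (*-identityʳ _))
        tidy : ∀ a q c → a + (- q) * c ≡ a - q * c
        tidy = solve-∀ ℚ-ring

    moment-relation : (x - q * y) * A ≡ (1ℚ - q * x * y) * S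
    moment-relation = eliminate-B-C-D S A B C D x y q E₁ E₂ E₃ E₄

    S≡Σf : S ≡ doubleSum N f
    S≡Σf = doubleSum-cong N (λ i j → *-identityʳ (f i j))

    summandSum-recurrenceᴹ : doubleSum N (F L (suc M)) ≡ (1ℚ + (q * q) * (y * y)) * S + (q * y) * (A + A)
    summandSum-recurrenceᴹ = begin
      doubleSum N (F L (suc M))
        ≡⟨ doubleSum-cong N (summand-recurrenceᴹ L M) ⟩
      doubleSum N (λ i j → (1ℚ + (q * q) * (y * y)) * f i j + (q * y) * (w i * f i (j ℤ.- + 1) + w (ℤ.- i) * f i (j ℤ.+ + 1)))
        ≡⟨ doubleSum-linear N (1ℚ + (q * q) * (y * y)) (q * y) f (λ i j → w i * f i (j ℤ.- + 1) + w (ℤ.- i) * f i (j ℤ.+ + 1)) ⟩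
      (1ℚ + (q * q) * (y * y)) * doubleSum N f + (q * y) * doubleSum N (λ i j → w i * f i (j ℤ.- + 1) + w (ℤ.- i) * f i (j ℤ.+ + 1))
        ≡⟨ cong₂ (λ s t → (1ℚ + (q * q) * (y * y)) * s + (q * y) * t) (sym S≡Σf)
                 (trans (doubleSum-+ N (λ i j → w i * f i (j ℤ.- + 1)) (λ i j → w (ℤ.- i) * f i (j ℤ.+ + 1))) (cong₂ _+_ down up)) ⟩
      (1ℚ + (q * q) * (y * y)) * S + (q * y) * (A + A) ∎
      where
      open ≡-Reasoning
      down : doubleSum N (λ i j → w i * f i (j ℤ.- + 1)) ≡ A
      down = trans (doubleSum-shiftʲ⁻ (vanishesOutside-*ˡ (summand-vanishes L M) (λ i _ → w i)) M<N)
                   (doubleSum-cong N (λ i j → *-comm (w i) (f i j)))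
      up : doubleSum N (λ i j → w (ℤ.- i) * f i (j ℤ.+ + 1)) ≡ A
      up = trans (doubleSum-shiftʲ⁺ (vanishesOutside-*ˡ (summand-vanishes L M) (λ i _ → w (ℤ.- i))) M<N)
                 (trans (doubleSum-cong N (λ i j → *-comm (w (ℤ.- i)) (f i j))) A-reflect)

    summandSum-stepᴹ : (x - q * y) * doubleSum N (F L (suc M)) ≡ (x + q * y) * (1ℚ - (q * q) * (y * y)) * doubleSum N f
    summandSum-stepᴹ = begin
      (x - q * y) * doubleSum N (F L (suc M))
        ≡⟨ cong ((x - q * y) *_) summandSum-recurrenceᴹ ⟩
      (x - q * y) * ((1ℚ + (q * q) * (y * y)) * S + (q * y) * (A + A))
        ≡⟨ expand S A x y q ⟩
      (x - q * y) * (1ℚ + (q * q) * (y * y)) * S + (1ℚ + 1ℚ) * (q * y) * ((x - q * y) * A)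
        ≡⟨ cong (λ z → (x - q * y) * (1ℚ + (q * q) * (y * y)) * S + (1ℚ + 1ℚ) * (q * y) * z) moment-relation ⟩
      (x - q * y) * (1ℚ + (q * q) * (y * y)) * S + (1ℚ + 1ℚ) * (q * y) * ((1ℚ - q * x * y) * S)
        ≡⟨ factor S x y q ⟩
      (x + q * y) * (1ℚ - (q * q) * (y * y)) * S
        ≡⟨ cong ((x + q * y) * (1ℚ - (q * q) * (y * y)) *_) S≡Σf ⟩
      (x + q * y) * (1ℚ - (q * q) * (y * y)) * doubleSum N f ∎
      where
      open ≡-Reasoning
      expand : ∀ S A x y q → (x - q * y) * ((1ℚ + (q * q) * (y * y)) * S + (q * y) * (A + A))
             ≡ (x - q * y) * (1ℚ + (q * q) * (y * y)) * S + (1ℚ + 1ℚ) * (q * y) * ((x - q * y) * A)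
      expand = solve-∀ ℚ-ring
      factor : ∀ S x y q → (x - q * y) * (1ℚ + (q * q) * (y * y)) * S + (1ℚ + 1ℚ) * (q * y) * ((1ℚ - q * x * y) * S)
             ≡ (x + q * y) * (1ℚ - (q * q) * (y * y)) * S
      factor = solve-∀ ℚ-ring

  -- The case M = 0

  concentrated-weight : ∀ L (u : ℤ → ℚ) → u (+ 0) ≡ 1ℚ → ∀ i j → u j * F L 0 i j ≡ F L 0 i j
  concentrated-weight L u u0≡1 i (+ zero)    = trans (cong (_* F L 0 i (+ 0)) u0≡1) (*-identityˡ _)
  concentrated-weight L u u0≡1 i (+ suc m)   = vanishing-weight (+ suc m) (s≤s z≤n)
    where vanishing-weight : ∀ j → 0 ℕ.< ∣ j ∣ → u j * F L 0 i j ≡ F L 0 i j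
          vanishing-weight j 0<∣j∣ = trans (vanishesOutside-*ˡ (summand-vanishes L 0) (λ _ j → u j) i j (inj₂ 0<∣j∣))
                                           (sym (summand-vanishes L 0 i j (inj₂ 0<∣j∣)))
  concentrated-weight L u u0≡1 i -[1+ m ]    =
    trans (vanishesOutside-*ˡ (summand-vanishes L 0) (λ _ j → u j) i -[1+ m ] (inj₂ (s≤s z≤n)))
          (sym (summand-vanishes L 0 i -[1+ m ] (inj₂ (s≤s z≤n))))

  summandSum-stepᴸ : ∀ L N → L ℕ.< N →
    doubleSum N (F (suc L) 0) ≡ (1ℚ - q * w (+ L)) * (1ℚ - q * w (+ L)) * doubleSum N (F L 0)
  summandSum-stepᴸ L N L<N = begin
    doubleSum N (F (suc L) 0)
      ≡⟨ doubleSum-cong N (λ i j → trans (summand-recurrenceᴸ L 0 i j) (subtract (a * f i j) (q * x) (G i j))) ⟩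
    doubleSum N (λ i j → a * f i j + (- (q * x)) * G i j)
      ≡⟨ doubleSum-linear N a (- (q * x)) f G ⟩
    a * S + (- (q * x)) * doubleSum N G
      ≡⟨ cong (λ t → a * S + (- (q * x)) * t)
              (trans (doubleSum-+ N (λ i j → w j * f (i ℤ.- + 1) j) (λ i j → w (ℤ.- j) * f (i ℤ.+ + 1) j)) (cong₂ _+_ down up)) ⟩
    a * S + (- (q * x)) * (S + S)
      ≡⟨ square S q x ⟩
    (1ℚ - q * x) * (1ℚ - q * x) * S ∎
    where
    open ≡-Reasoning
    f = F L 0
    x = w (+ L)
    a = 1ℚ + (q * q) * (x * x)
    S = doubleSum N f
    G = λ i j → w j * f (i ℤ.- + 1) j + w (ℤ.- j) * f (i ℤ.+ + 1) j
    subtract : ∀ a b c → a - b * c ≡ a + (- b) * c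
    subtract = solve-∀ ℚ-ring
    square : ∀ S q x → (1ℚ + (q * q) * (x * x)) * S + (- (q * x)) * (S + S) ≡ (1ℚ - q * x) * (1ℚ - q * x) * S
    square = solve-∀ ℚ-ring
    down : doubleSum N (λ i j → w j * f (i ℤ.- + 1) j) ≡ S
    down = trans (doubleSum-shiftⁱ⁻ (vanishesOutside-*ˡ (summand-vanishes L 0) (λ _ j → w j)) L<N)
                 (doubleSum-cong N (concentrated-weight L w refl))
    up : doubleSum N (λ i j → w (ℤ.- j) * f (i ℤ.+ + 1) j) ≡ S
    up = trans (doubleSum-shiftⁱ⁺ (vanishesOutside-*ˡ (summand-vanishes L 0) (λ _ j → w (ℤ.- j))) L<N)
               (doubleSum-cong N (concentrated-weight L (λ j → w (ℤ.- j)) refl))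

  summandSum₀₀ : ∀ N → doubleSum N (F 0 0) ≡ 1ℚ
  summandSum₀₀ N = trans (symSum-concentrated N _ (rowSums-vanish (summand-vanishes 0 0) N))
                         (symSum-concentrated N _ (λ j 0<∣j∣ → summand-vanishes 0 0 (+ 0) j (inj₂ 0<∣j∣)))

  summandSum-base : ∀ L N → L ℕ.< N → doubleSum N (F L 0) ≡ pochPos q (q ^ 2) L * pochPos q (q ^ 2) L
  summandSum-base zero    N _   = summandSum₀₀ N
  summandSum-base (suc L) N L<N = begin
    doubleSum N (F (suc L) 0)                                 ≡⟨ summandSum-stepᴸ L N (ℕₚ.<-trans (ℕₚ.n<1+n L) L<N) ⟩
    (1ℚ - q * w (+ L)) * (1ℚ - q * w (+ L)) * doubleSum N (F L 0)
                                                              ≡⟨ cong (λ z → (1ℚ - q * w (+ L)) * (1ℚ - q * w (+ L)) * z)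
                                                                      (summandSum-base L N (ℕₚ.<-trans (ℕₚ.n<1+n L) L<N)) ⟩
    (1ℚ - q * w (+ L)) * (1ℚ - q * w (+ L)) * (P * P)        ≡⟨ rearrange (1ℚ - q * w (+ L)) P ⟩
    (P * (1ℚ - q * w (+ L))) * (P * (1ℚ - q * w (+ L)))      ∎
    where
    open ≡-Reasoning
    P = pochPos q (q ^ 2) L
    rearrange : ∀ a P → a * a * (P * P) ≡ (P * a) * (P * a)
    rearrange = solve-∀ ℚ-ring

  -- The right-hand side

  private
    p : ℚ
    p = q ^ 2

    pochRatio : ℤ → ℚ
    pochRatio d = poch q p d * inv (poch (- q) p d)

  q*inv-p^suc≢1 : ∀ k → q * inv p ^ suc k ≢ 1ℚ
  q*inv-p^suc≢1 k q*p⁻ᵏ⁻¹≡1 = ^ℤ≢1 {+ 1 ℤ.+ (-[1+ k ] ℤ.+ -[1+ k ])} (λ ()) (begin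
    q ^ℤ (+ 1 ℤ.+ (-[1+ k ] ℤ.+ -[1+ k ]))   ≡⟨ q*w≡^ℤ -[1+ k ] ⟨
    q * inv (p ^ suc k)                      ≡⟨ cong (q *_) (inv-^ p (suc k)) ⟨
    q * inv p ^ suc k                        ≡⟨ q*p⁻ᵏ⁻¹≡1 ⟩
    1ℚ                                       ∎)
    where open ≡-Reasoning

  -q*p^≢1 : ∀ e → (- q) * p ^ e ≢ 1ℚ
  -q*p^≢1 e -q*pᵉ≡1 = ^ℤ≢-1 (+ 1 ℤ.+ (+ e ℤ.+ + e))
    (trans (sym (q*w≡^ℤ (+ e))) (trans (negate q (p ^ e)) (cong -_ -q*pᵉ≡1)))
    where negate : ∀ a b → a * b ≡ - ((- a) * b)
          negate = solve-∀ ℚ-ring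

  pochPos-≢0 : ∀ L → pochPos (- q) p L ≢ 0ℚ
  pochPos-≢0 zero    = 1≢0
  pochPos-≢0 (suc L) = *-≢0 (pochPos-≢0 L) (1-x≢0 (-q*p^≢1 L))

  pochRatio-step⁺ : ∀ x y e → x ≡ y * ((q * q) * p ^ e) →
    (x - q * y) * pochRatio (+ e) ≡ - (x + q * y) * pochRatio (+ suc e)
  pochRatio-step⁺ .(y * ((q * q) * p ^ e)) y e refl = begin
    (X - q * y) * (P₊ * iP₋)                        ≡⟨ *-identityʳ _ ⟨
    (X - q * y) * (P₊ * iP₋) * 1ℚ                   ≡⟨ cong ((X - q * y) * (P₊ * iP₋) *_) (inv-inverseʳ (1-x≢0 (-q*p^≢1 e))) ⟨
    (X - q * y) * (P₊ * iP₋) * (W * inv W)          ≡⟨ rearrange y q (p ^ e) P₊ iP₋ (inv W) ⟩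
    - (X + q * y) * ((P₊ * (1ℚ - q * p ^ e)) * (iP₋ * inv W))
                                                    ≡⟨ cong (λ z → - (X + q * y) * ((P₊ * (1ℚ - q * p ^ e)) * z)) (inv-*-distrib P₋ W) ⟨
    - (X + q * y) * pochRatio (+ suc e)             ∎
    where
    open ≡-Reasoning
    X = y * ((q * q) * p ^ e)
    P₊ = pochPos q p e
    P₋ = pochPos (- q) p e
    iP₋ = inv P₋
    W = 1ℚ - (- q) * p ^ e
    rearrange : ∀ y q pᵉ P₊ iP₋ iW → (y * ((q * q) * pᵉ) - q * y) * (P₊ * iP₋) * ((1ℚ - (- q) * pᵉ) * iW)
              ≡ - (y * ((q * q) * pᵉ) + q * y) * ((P₊ * (1ℚ - q * pᵉ)) * (iP₋ * iW))
    rearrange = solve-∀ ℚ-ring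

  inv-p^suc*q²p^≡1 : ∀ k → inv p ^ suc k * (q * q * p ^ k) ≡ 1ℚ
  inv-p^suc*q²p^≡1 k = begin
    inv p ^ suc k * (q * q * p ^ k)    ≡⟨ cong (λ z → inv p ^ suc k * (z * p ^ k)) (sym (cong (q *_) (*-identityʳ q))) ⟩
    inv p ^ suc k * p ^ suc k          ≡⟨ ^-distribʳ-* (inv p) p (suc k) ⟨
    (inv p * p) ^ suc k                ≡⟨ cong (_^ suc k) (trans (*-comm (inv p) p) (inv-inverseʳ (^-≢0 q≢0 2))) ⟩
    1ℚ ^ suc k                         ≡⟨ ^-zeroˡ (suc k) ⟩
    1ℚ                                 ∎
    where open ≡-Reasoning

  private
    pochNegRatio : ℕ → ℚ
    pochNegRatio k = pochNeg q p k * inv (pochNeg (- q) p k)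

  pochRatio-step⁻ : ∀ x y k → y ≡ x * p ^ k →
    (x - q * y) * pochNegRatio (suc k) ≡ - (x + q * y) * pochNegRatio k
  pochRatio-step⁻ x .(x * p ^ k) k refl = begin
    (x - q * Y) * ((N₊ * iA) * inv (N₋ * inv B))
      ≡⟨ cong (λ z → (x - q * Y) * ((N₊ * iA) * z)) (trans (inv-*-distrib N₋ (inv B)) (cong (inv N₋ *_) (inv-involutive B))) ⟩
    (x - q * Y) * ((N₊ * iA) * (inv N₋ * B))
      ≡⟨ rearrange x (p ^ k) N₊ iA (inv N₋) u q ⟩
    - (x + q * Y) * (N₊ * inv N₋) * ((1ℚ - q * u) * iA) + (1ℚ + 1ℚ) * x * N₊ * inv N₋ * iA * (1ℚ - u * (q * q * p ^ k))
      ≡⟨ cong₂ (λ a b → - (x + q * Y) * (N₊ * inv N₋) * a + (1ℚ + 1ℚ) * x * N₊ * inv N₋ * iA * (1ℚ - b))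
               (inv-inverseʳ (1-x≢0 (q*inv-p^suc≢1 k))) (inv-p^suc*q²p^≡1 k) ⟩
    - (x + q * Y) * (N₊ * inv N₋) * 1ℚ + (1ℚ + 1ℚ) * x * N₊ * inv N₋ * iA * (1ℚ - 1ℚ)
      ≡⟨ drop (- (x + q * Y) * (N₊ * inv N₋)) ((1ℚ + 1ℚ) * x * N₊ * inv N₋ * iA) ⟩
    - (x + q * Y) * pochNegRatio k ∎
    where
    open ≡-Reasoning
    Y = x * p ^ k
    u = inv p ^ suc k
    N₊ = pochNeg q p k
    N₋ = pochNeg (- q) p k
    A = 1ℚ - q * u
    B = 1ℚ - (- q) * u
    iA = inv A
    rearrange : ∀ x pᵏ N₊ iA iN₋ u q → (x - q * (x * pᵏ)) * ((N₊ * iA) * (iN₋ * (1ℚ - (- q) * u)))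
              ≡ - (x + q * (x * pᵏ)) * (N₊ * iN₋) * ((1ℚ - q * u) * iA) + (1ℚ + 1ℚ) * x * N₊ * iN₋ * iA * (1ℚ - u * (q * q * pᵏ))
    rearrange = solve-∀ ℚ-ring
    drop : ∀ a b → a * 1ℚ + b * (1ℚ - 1ℚ) ≡ a
    drop = solve-∀ ℚ-ring

  pochRatio-step : ∀ x y d → x ≡ y * w d → (x - q * y) * pochRatio (d ℤ.- + 1) ≡ - (x + q * y) * pochRatio d
  pochRatio-step x y (+ suc e) x≡y*wd =
    pochRatio-step⁺ x y e (trans x≡y*wd (cong (y *_) (q²*q²ᵉ q (p ^ e))))
    where q²*q²ᵉ : ∀ q a → (q * (q * 1ℚ)) * a ≡ (q * q) * a
          q²*q²ᵉ = solve-∀ ℚ-ring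
  pochRatio-step x y (+ zero)  x≡y*wd =
    pochRatio-step⁻ x y 0 (trans (y≡y*1*1 y) (cong (_* 1ℚ) (sym x≡y*wd)))
    where y≡y*1*1 : ∀ y → y ≡ (y * 1ℚ) * 1ℚ
          y≡y*1*1 = solve-∀ ℚ-ring
  pochRatio-step x y -[1+ k ]  x≡y*wd =
    trans (cong (λ m → (x - q * y) * pochRatio -[1+ suc m ]) (ℕₚ.+-identityʳ k))
          (pochRatio-step⁻ x y (suc k) (sym (begin
            x * p ^ suc k                      ≡⟨ cong (_* p ^ suc k) x≡y*wd ⟩
            y * w -[1+ k ] * w (+ suc k)       ≡⟨ *-assoc y _ _ ⟩
            y * (w -[1+ k ] * w (+ suc k))     ≡⟨ cong (y *_) (w-inverse -[1+ k ]) ⟩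
            y * 1ℚ                             ≡⟨ *-identityʳ y ⟩
            y                                  ∎)))
    where open ≡-Reasoning

  q²*q⁴ⁿ : ∀ n → p * (q ^ 4) ^ n ≡ (q * q) * (p ^ n * p ^ n)
  q²*q⁴ⁿ n = cong₂ _*_ (q²≡q*q q) (trans (cong (_^ n) (q⁴≡q²*q² q)) (^-distribʳ-* p p n))
    where
    q⁴≡q²*q² : ∀ q → q * (q * (q * (q * 1ℚ))) ≡ (q * (q * 1ℚ)) * (q * (q * 1ℚ))
    q⁴≡q²*q² = solve-∀ ℚ-ring
    q²≡q*q : ∀ q → q * (q * 1ℚ) ≡ q * q
    q²≡q*q = solve-∀ ℚ-ring

  pochPos-q⁴-split : ∀ L → pochPos p (q ^ 4) L ≡ pochPos q p L * pochPos (- q) p L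
  pochPos-q⁴-split zero    = refl
  pochPos-q⁴-split (suc L) = trans (cong₂ (λ u v → u * (1ℚ - v)) (pochPos-q⁴-split L) (q²*q⁴ⁿ L))
                                   (difference-of-squares (pochPos q p L) (pochPos (- q) p L) q (p ^ L))
    where
    difference-of-squares : ∀ P₊ P₋ q pᴸ → P₊ * P₋ * (1ℚ - (q * q) * (pᴸ * pᴸ)) ≡ (P₊ * (1ℚ - q * pᴸ)) * (P₋ * (1ℚ - (- q) * pᴸ))
    difference-of-squares = solve-∀ ℚ-ring

  rhs-base : ∀ L → rhs q L 0 ≡ pochPos q p L * pochPos q p L
  rhs-base L = begin
    rhs q L 0                                  ≡⟨ cong (λ n → 1ℚ * pochPos q p n * inv (pochPos (- q) p n) * pochPos p (q ^ 4) L * 1ℚ) (ℕₚ.+-identityʳ L) ⟩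
    1ℚ * P₊ * inv P₋ * pochPos p (q ^ 4) L * 1ℚ ≡⟨ cong (λ z → 1ℚ * P₊ * inv P₋ * z * 1ℚ) (pochPos-q⁴-split L) ⟩
    1ℚ * P₊ * inv P₋ * (P₊ * P₋) * 1ℚ          ≡⟨ rearrange P₊ P₋ (inv P₋) ⟩
    P₊ * P₊ * (P₋ * inv P₋)                    ≡⟨ cong (P₊ * P₊ *_) (inv-inverseʳ (pochPos-≢0 L)) ⟩
    P₊ * P₊ * 1ℚ                               ≡⟨ *-identityʳ (P₊ * P₊) ⟩
    P₊ * P₊                                    ∎
    where
    open ≡-Reasoning
    P₊ = pochPos q p L
    P₋ = pochPos (- q) p L
    rearrange : ∀ a b ib → 1ℚ * a * ib * (a * b) * 1ℚ ≡ a * a * (b * ib)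
    rearrange = solve-∀ ℚ-ring

  rhs-stepᴹ : ∀ L M → (w (+ L) - q * w (+ M)) * rhs q L (suc M)
                    ≡ (w (+ L) + q * w (+ M)) * (1ℚ - (q * q) * (w (+ M) * w (+ M))) * rhs q L M
  rhs-stepᴹ L M = begin
    (x - q * y) * (((((- 1ℚ * s) * a′) * b′) * Pᴸ) * (Pᴹ * (1ℚ - p * (q ^ 4) ^ M)))
      ≡⟨ rearrange₁ x y q s a′ b′ Pᴸ Pᴹ (p * (q ^ 4) ^ M) ⟩
    ((- 1ℚ * s) * Pᴸ * Pᴹ * (1ℚ - p * (q ^ 4) ^ M)) * ((x - q * y) * (a′ * b′))
      ≡⟨ cong (((- 1ℚ * s) * Pᴸ * Pᴹ * (1ℚ - p * (q ^ 4) ^ M)) *_) ratio-step ⟩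
    ((- 1ℚ * s) * Pᴸ * Pᴹ * (1ℚ - p * (q ^ 4) ^ M)) * (- (x + q * y) * (a * b))
      ≡⟨ rearrange₂ x y q s a b Pᴸ Pᴹ (p * (q ^ 4) ^ M) ⟩
    (x + q * y) * (1ℚ - p * (q ^ 4) ^ M) * ((((s * a) * b) * Pᴸ) * Pᴹ)
      ≡⟨ cong (λ z → (x + q * y) * (1ℚ - z) * ((((s * a) * b) * Pᴸ) * Pᴹ)) (q²*q⁴ⁿ M) ⟩
    (x + q * y) * (1ℚ - (q * q) * (y * y)) * rhs q L M ∎
    where
    open ≡-Reasoning
    x = w (+ L)
    y = w (+ M)
    s = sgn (+ M)
    d = + L ℤ.- + M
    a = poch q p d
    b = inv (poch (- q) p d)
    a′ = poch q p (+ L ℤ.- + suc M)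
    b′ = inv (poch (- q) p (+ L ℤ.- + suc M))
    Pᴸ = pochPos p (q ^ 4) L
    Pᴹ = pochPos p (q ^ 4) M
    L-M-1 : ∀ L M → L ℤ.- M ℤ.- + 1 ≡ L ℤ.- (+ 1 ℤ.+ M)
    L-M-1 = ℤ-Solver.solve-∀
    M+[L-M] : ∀ L M → M ℤ.+ (L ℤ.- M) ≡ L
    M+[L-M] = ℤ-Solver.solve-∀
    x≡y*w[L-M] : x ≡ y * w d
    x≡y*w[L-M] = trans (cong w (sym (M+[L-M] (+ L) (+ M)))) (w-+ (+ M) d)
    ratio-step : (x - q * y) * (a′ * b′) ≡ - (x + q * y) * (a * b)
    ratio-step = trans (cong (λ z → (x - q * y) * pochRatio z) (sym (L-M-1 (+ L) (+ M)))) (pochRatio-step x y d x≡y*w[L-M])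
    rearrange₁ : ∀ x y q s a′ b′ Pᴸ Pᴹ u → (x - q * y) * (((((- 1ℚ * s) * a′) * b′) * Pᴸ) * (Pᴹ * (1ℚ - u)))
               ≡ ((- 1ℚ * s) * Pᴸ * Pᴹ * (1ℚ - u)) * ((x - q * y) * (a′ * b′))
    rearrange₁ = solve-∀ ℚ-ring
    rearrange₂ : ∀ x y q s a b Pᴸ Pᴹ u → ((- 1ℚ * s) * Pᴸ * Pᴹ * (1ℚ - u)) * (- (x + q * y) * (a * b))
               ≡ (x + q * y) * (1ℚ - u) * ((((s * a) * b) * Pᴸ) * Pᴹ)
    rearrange₂ = solve-∀ ℚ-ring

  summandSum≡rhs : ∀ L M N → L ℕ.< N → M ℕ.< N → doubleSum N (F L M) ≡ rhs q L M
  summandSum≡rhs L zero    N L<N _   = trans (summandSum-base L N L<N) (sym (rhs-base L))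
  summandSum≡rhs L (suc M) N L<N M+1<N = *-cancelˡ (x-qy≢0 L M) (begin
    (x - q * y) * doubleSum N (F L (suc M))     ≡⟨ summandSum-stepᴹ L M N L<N M<N ⟩
    (x + q * y) * k * doubleSum N (F L M)       ≡⟨ cong ((x + q * y) * k *_) (summandSum≡rhs L M N L<N M<N) ⟩
    (x + q * y) * k * rhs q L M                 ≡⟨ rhs-stepᴹ L M ⟨
    (x - q * y) * rhs q L (suc M)               ∎)
    where
    open ≡-Reasoning
    M<N = ℕₚ.<-trans (ℕₚ.n<1+n M) M+1<N
    x = w (+ L)
    y = w (+ M)
    k = 1ℚ - (q * q) * (y * y)

mainTheorem2 : (q : ℚ) → q ≢ 0ℚ → q ≢ 1ℚ → q ≢ - 1ℚ →
    (L M N : ℕ) → L ≤ N → M ≤ N →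
    lhsSum q L M N ≡ rhs q L M
mainTheorem2 q q≢0 q≢1 q≢-1 L M N L≤N M≤N = begin
  lhsSum q L M N                      ≡⟨ doubleSum-cong N (lhsTerm≡summand q≢0 q²^suc≢1 L M) ⟩
  doubleSum N (summand q L M)         ≡⟨ doubleSum-extend (summand-vanishes q≢0 q²^suc≢1 L M) L≤N M≤N ⟨
  doubleSum (suc N) (summand q L M)   ≡⟨ summandSum≡rhs q≢0 q²^suc≢1 L M (suc N) (s≤s L≤N) (s≤s M≤N) ⟩
  rhs q L M                           ∎
  where
  open ≡-Reasoning
  q²^suc≢1 : ∀ m → (q ^ 2) ^ suc m ≢ 1ℚ
  q²^suc≢1 = pos-^-suc≢1 (²-pos q≢0) (²≢1 q≢1 q≢-1)
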